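{- Let $\mathcal{C}$ be a permutation class. The following are equivalent. (1) There exists a $\mathsf{TOTO}$ formula $\phi(x,y)$ such that for every $\sigma\in\mathcal{C}$ and every pair $(a,b)$ of elements of $\sigma$, $(\sigma,a,b)\models\phi(x,y)$ if and only if $(a,b)$ is a transposition of $\sigma$. (2) There exist integers $k\ge2$, $m\ge1$, $n\ge1$ such that neither $\delta_k$ nor $\iota_m\ominus\iota_n$ belongs to $\mathcal{C}$.
   Context: A permutation $\sigma$ of size $N$ is identified with the finite structure with domain $A^\sigma=\{(i,\sigma(i)) : 1\le i\le N\}$, position order $<_P$ (comparing first coordinates) and value order $<_V$ (comparing second coordinates); $\mathsf{TOTO}$ is first-order logic with equality over $\{<_P,<_V\}$. A pair $(a,b)=((i,\sigma(i)),(j,\sigma(j)))$ is a transposition of $\sigma$ if $i\ne j$, $\sigma(i)=j$ and $\sigma(j)=i$. A permutation class is a set of permutations closed under taking patterns. $\iota_n=12\cdots n$, $\delta_k=k\cdots21$, and $\iota_m\ominus\iota_n=21[\iota_m,\iota_n]$ is the permutation $(n+1)(n+2)\cdots(n+m)\,1\,2\cdots n$. -}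

module Defs where

open import Data.Nat using (ℕ; zero; suc; _+_; _∸_; _<ᵇ_)
open import Data.Fin using (Fin; toℕ; _<_) renaming (zero to fz; suc to fs)
open import Data.Bool using (if_then_else_)
open import Data.Product using (Σ; _×_; _,_)
open import Data.Empty using (⊥)
open import Data.Unit using (⊤)
open import Data.Sum using (_⊎_)
open import Relation.Binary.PropositionalEquality using (_≡_; _≢_)
open import Function.Definitions using (Injective)
open import Function.Bundles using (_⇔_)

-- A permutation of size N: an injective (hence bijective) map on Fin N.
-- Element i of the structure is the point (i , σ i) (0-indexed).
Perm : ℕ → Set
Perm N = Σ (Fin N → Fin N) (Injective _≡_ _≡_)

_≼_ : ∀ {k N} → Perm k → Perm N → Set
_≼_ {k} {N} (τ , _) (σ , _) =
  Σ (Fin k → Fin N) λ f →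
    (∀ i j → i < j → f i < f j) ×
    (∀ i j → (τ i < τ j) ⇔ (σ (f i) < σ (f j)))

PermClass : Set₁
PermClass = ∀ N → Perm N → Set

IsPermClass : PermClass → Set
IsPermClass C = ∀ {k N} (τ : Perm k) (σ : Perm N) → τ ≼ σ → C N σ → C k τ

IsDecreasing : ∀ k → Perm k → Set
IsDecreasing k (σ , _) = ∀ i → toℕ (σ i) ≡ k ∸ 1 ∸ toℕ i

-- ι_m ⊖ ι_n = (n+1)⋯(n+m) 1 2 ⋯ n  (0-indexed)
IsIotaMinusIota : ∀ m n → Perm (m + n) → Set
IsIotaMinusIota m n (σ , _) =
  ∀ i → toℕ (σ i) ≡ (if toℕ i <ᵇ m then n + toℕ i else toℕ i ∸ m)

_∈δ_ : ℕ → PermClass → Set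
k ∈δ C = Σ (Perm k) λ σ → IsDecreasing k σ × C k σ

_,_∈⊖_ : ℕ → ℕ → PermClass → Set
m , n ∈⊖ C = Σ (Perm (m + n)) λ σ → IsIotaMinusIota m n σ × C (m + n) σ

-- TOTO formulas with free variables among Fin v (de Bruijn)
data Formula (v : ℕ) : Set where
  _≐_  : Fin v → Fin v → Formula v
  _<P_ : Fin v → Fin v → Formula v
  _<V_ : Fin v → Fin v → Formula v
  ⊤′ ⊥′ : Formula v
  ¬′_  : Formula v → Formula v
  _∧′_ _∨′_ _⇒′_ : Formula v → Formula v → Formula v
  ∃′ ∀′ : Formula (suc v) → Formula v

extend : ∀ {v N} → (Fin v → Fin N) → Fin N → Fin (suc v) → Fin N
extend ρ a fz     = a
extend ρ a (fs i) = ρ i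

Sat : ∀ {N v} → Perm N → (Fin v → Fin N) → Formula v → Set
Sat σ ρ (x ≐ y)  = ρ x ≡ ρ y
Sat σ ρ (x <P y) = ρ x < ρ y
Sat (σ , _) ρ (x <V y) = σ (ρ x) < σ (ρ y)
Sat σ ρ ⊤′ = ⊤
Sat σ ρ ⊥′ = ⊥
Sat σ ρ (¬′ φ) = Sat σ ρ φ → ⊥
Sat σ ρ (φ ∧′ ψ) = Sat σ ρ φ × Sat σ ρ ψ
Sat σ ρ (φ ∨′ ψ) = Sat σ ρ φ ⊎ Sat σ ρ ψ
Sat σ ρ (φ ⇒′ ψ) = Sat σ ρ φ → Sat σ ρ ψ
Sat {N} σ ρ (∃′ φ) = Σ (Fin N) λ a → Sat σ (extend ρ a) φ
Sat {N} σ ρ (∀′ φ) = (a : Fin N) → Sat σ (extend ρ a) φ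

-- assignment x ↦ a (variable 0), y ↦ b (variable 1)
pair : ∀ {N} → Fin N → Fin N → Fin 2 → Fin N
pair a b fz = a
pair a b (fs _) = b

IsTransposition : ∀ {N} → Perm N → Fin N → Fin N → Set
IsTransposition (σ , _) a b = (a ≢ b) × (σ a ≡ b) × (σ b ≡ a)

-- (2) ⇒ (1).  Split the points below b in position and the points below σ(a) in value into
-- their common part and the two sets S₁ = {z <P b, z ≥V a} and S₂ = {z <V a, z ≥P b}; then
-- σ(a) = b iff |S₁| = |S₂|.  Every point of S₁ lies left of and above every point of S₂, so by
-- Erdős–Szekeres large S₁ and S₂ would contain δ_k or ι_m ⊖ ι_n.  Hence in 𝒞 the test
-- |S₁| = |S₂| only involves counts below a fixed bound, and such counting is first-order.
--
-- (1) ⇒ (2).  Call two assignments alike at scale t if all gaps between their points and a few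
-- fixed cut points agree, except that gaps of length ≥ t need only agree in direction.  A point
-- added to one of two assignments alike at scale 2u can be matched in the other so that they
-- stay alike at scale u; so assignments alike at scale 2^(quantifier depth of φ) satisfy φ
-- alike, as long as the value order is determined by positions and cuts (Ehrenfeucht–Fraïssé).
-- This holds in δ_K, and in ι_M ⊖ ι_M with a cut at M, and for large K and M these contain a
-- transposition (x, y) alike to a non-transposition (x, y′).
module Submission where

open import Defs
open import Data.Bool using (true; false)
open import Data.Nat as ℕ
  using (ℕ; zero; suc; _+_; _∸_; _⊔_; z≤n; s≤s; _<ᵇ_)
  renaming (_≤_ to _≤ℕ_; _<_ to _<ℕ_)
import Data.Nat.Properties as ℕₚ
open import Data.Fin as Fin using (Fin; toℕ; fromℕ<; opposite; _<_; _≤_; _↑ˡ_; _↑ʳ_; splitAt; join)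
  renaming (zero to fz; suc to fs)
import Data.Fin.Properties as Finₚ
open import Data.Product using (Σ; _×_; _,_; proj₁; proj₂) renaming (swap to ×-swap)
open import Data.Product.Function.NonDependent.Propositional using (_×-⇔_)
open import Data.Product.Function.Dependent.Propositional using (Σ-⇔)
open import Data.Sum using (_⊎_; inj₁; inj₂; swap)
open import Data.Sum.Properties using (swap-involutive)
open import Data.Sum.Function.Propositional using (_⊎-⇔_)
open import Data.Empty using (⊥; ⊥-elim)
open import Data.Unit using (tt)
open import Function.Base using (_∘_)
open import Function.Bundles using (_⇔_; mk⇔; Equivalence)
open import Function.Construct.Identity using (⇔-id; ↠-id)
open import Function.Construct.Symmetry using (⇔-sym)
open import Function.Construct.Composition using (_⇔-∘_)
open import Function.Definitions using (Injective)
open import Function.Properties.Equivalence using (⇔-setoid)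
open import Level using (0ℓ)
import Relation.Binary.Reasoning.Setoid
open import Function.Related.TypeIsomorphisms using (→-cong-⇔; ¬-cong-⇔)
open import Relation.Nullary using (¬_; Dec; yes; no)
open import Relation.Nullary.Reflects using (ofʸ; ofⁿ)
open import Relation.Nullary.Decidable using (_×-dec_; _⊎-dec_; _→-dec_; ¬?)
open import Relation.Unary using (Decidable; _∩_; ∁)
open import Relation.Unary.Properties using (_∩?_; ∁?)
open import Relation.Binary.Definitions using (tri<; tri≈; tri>)
open import Relation.Binary.PropositionalEquality
open import Data.List using (_∷_; [])
open import Data.Nat.Tactic.RingSolver using (solve)

open Equivalence using (to; from)
module ⇔-Reasoning = Relation.Binary.Reasoning.Setoid (⇔-setoid 0ℓ)
open import Algebra.Properties.CommutativeSemigroup ℕₚ.+-commutativeSemigroup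
  using () renaming (interchange to +-interchange; x∙yz≈y∙xz to +-left-comm)

-- Counting

indicator : ∀ {A : Set} → Dec A → ℕ
indicator (yes _) = 1
indicator (no _)  = 0

count : ∀ {N} (P : Fin N → Set) → Decidable P → ℕ
count {zero}  P P? = 0
count {suc N} P P? = indicator (P? fz) + count (P ∘ fs) (P? ∘ fs)

indicator-cong : ∀ {A B : Set} (a? : Dec A) (b? : Dec B) → A ⇔ B → indicator a? ≡ indicator b?
indicator-cong (yes _) (yes _) _   = refl
indicator-cong (yes a) (no ¬b) A⇔B = ⊥-elim (¬b (to A⇔B a))
indicator-cong (no ¬a) (yes b) A⇔B = ⊥-elim (¬a (from A⇔B b))
indicator-cong (no _)  (no _)  _   = refl

count-cong : ∀ {N} {P Q : Fin N → Set} (P? : Decidable P) (Q? : Decidable Q) →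
  (∀ z → P z ⇔ Q z) → count P P? ≡ count Q Q?
count-cong {zero}  P? Q? P⇔Q = refl
count-cong {suc N} P? Q? P⇔Q =
  cong₂ _+_ (indicator-cong (P? fz) (Q? fz) (P⇔Q fz)) (count-cong (P? ∘ fs) (Q? ∘ fs) (P⇔Q ∘ fs))

count-empty : ∀ {N} {P : Fin N → Set} (P? : Decidable P) → (∀ z → ¬ P z) → count P P? ≡ 0
count-empty {zero}  P? ¬P = refl
count-empty {suc N} P? ¬P with P? fz
... | yes p = ⊥-elim (¬P fz p)
... | no _  = count-empty (P? ∘ fs) (¬P ∘ fs)

indicator-split : ∀ {A B : Set} (a? : Dec A) (b? : Dec B) →
  indicator a? ≡ indicator (a? ×-dec b?) + indicator (a? ×-dec ¬? b?)
indicator-split (yes _) (yes _) = refl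
indicator-split (yes _) (no _)  = refl
indicator-split (no _)  _       = refl

count-split : ∀ {N} {P Q : Fin N → Set} (P? : Decidable P) (Q? : Decidable Q) →
  count P P? ≡ count (P ∩ Q) (P? ∩? Q?) + count (P ∩ ∁ Q) (P? ∩? ∁? Q?)
count-split {zero}  P? Q? = refl
count-split {suc N} P? Q? = begin
  indicator (P? fz) + count _ (P? ∘ fs)
    ≡⟨ cong₂ _+_ (indicator-split (P? fz) (Q? fz)) (count-split (P? ∘ fs) (Q? ∘ fs)) ⟩
  (i₁ + i₂) + (c₁ + c₂)
    ≡⟨ +-interchange i₁ i₂ c₁ c₂ ⟩
  (i₁ + c₁) + (i₂ + c₂) ∎
  where
  open ≡-Reasoning
  i₁ = indicator (P? fz ×-dec Q? fz)
  i₂ = indicator (P? fz ×-dec ¬? (Q? fz))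
  c₁ = count _ ((P? ∘ fs) ∩? (Q? ∘ fs))
  c₂ = count _ ((P? ∘ fs) ∩? ∁? (Q? ∘ fs))

count-< : ∀ {N} (t : Fin N) → count {N} (_< t) (Finₚ._<? t) ≡ toℕ t
count-< {suc N} t@fz   = count-empty {N} {λ u → fs u < t} (λ u → fs u Finₚ.<? t) (λ _ ())
count-< {suc N} (fs t) = cong suc (begin
  count {N} (λ u → fs u < fs t) (λ u → fs u Finₚ.<? fs t)
    ≡⟨ count-cong {N} (λ u → fs u Finₚ.<? fs t) (Finₚ._<? t) (λ u → mk⇔ ℕ.s≤s⁻¹ s≤s) ⟩
  count {N} (_< t) (Finₚ._<? t)
    ≡⟨ count-< t ⟩
  toℕ t ∎)
  where open ≡-Reasoning

_≢?_ : ∀ {N} (u z : Fin N) → Dec (u ≢ z)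
u ≢? z = ¬? (u Finₚ.≟ z)

count-remove : ∀ {N} {P : Fin N → Set} (P? : Decidable P) {z : Fin N} → P z →
  count P P? ≡ suc (count (P ∩ (_≢ z)) (P? ∩? (_≢? z)))
count-remove {suc N} P? {fz} p with P? fz
... | no ¬p = ⊥-elim (¬p p)
... | yes _ = cong suc (count-cong (P? ∘ fs) ((P? ∘ fs) ∩? (_≢? fz ∘ fs)) (λ u → mk⇔ (_, λ ()) proj₁))
count-remove {suc N} {P} P? {fs z} p = begin
  indicator (P? fz) + count (P ∘ fs) (P? ∘ fs)
    ≡⟨ cong₂ _+_ (indicator-cong (P? fz) (P? fz ×-dec fz ≢? fs z) (mk⇔ (_, λ ()) proj₁))
                 (count-remove (P? ∘ fs) p) ⟩
  i + suc (count ((P ∘ fs) ∩ (_≢ z)) ((P? ∘ fs) ∩? (_≢? z)))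
    ≡⟨ cong (λ c → i + suc c) (count-cong ((P? ∘ fs) ∩? (_≢? z)) ((P? ∘ fs) ∩? (_≢? fs z) ∘ fs) λ u →
         mk⇔ (λ (q , u≢z) → q , u≢z ∘ Finₚ.suc-injective) (λ (q , su≢sz) → q , su≢sz ∘ cong fs)) ⟩
  i + suc (count (λ u → P (fs u) × fs u ≢ fs z) (λ u → P? (fs u) ×-dec fs u ≢? fs z))
    ≡⟨ ℕₚ.+-suc i _ ⟩
  suc (count (P ∩ (_≢ fs z)) (P? ∩? (_≢? fs z))) ∎
  where
  open ≡-Reasoning
  i = indicator (P? fz ×-dec fz ≢? fs z)

count-∁ : ∀ {N} {P : Fin N → Set} (P? : Decidable P) → count P P? + count (∁ P) (∁? P?) ≡ N
count-∁ {zero}  P? = refl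
count-∁ {suc N} P? with P? fz
... | yes _ = cong suc (count-∁ (P? ∘ fs))
... | no _  = trans (ℕₚ.+-suc _ _) (cong suc (count-∁ (P? ∘ fs)))

count-≤-injection : ∀ {N M} {Q : Fin N → Set} {P : Fin M → Set} (Q? : Decidable Q) (P? : Decidable P)
  {f : Fin N → Fin M} → Injective _≡_ _≡_ f → (∀ z → Q z → P (f z)) → count Q Q? ≤ℕ count P P?
count-≤-injection {zero}  Q? P? f-inj Q⇒Pf = z≤n
count-≤-injection {suc N} Q? P? {f} f-inj Q⇒Pf with Q? fz
... | no _  = count-≤-injection (Q? ∘ fs) P? (Finₚ.suc-injective ∘ f-inj) (Q⇒Pf ∘ fs)
... | yes q = begin
  suc (count _ (Q? ∘ fs))                     ≤⟨ s≤s (count-≤-injection (Q? ∘ fs) (P? ∩? (_≢? f fz))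
                                                     (Finₚ.suc-injective ∘ f-inj)
                                                     (λ z q → Q⇒Pf (fs z) q , fs≢fz ∘ f-inj)) ⟩
  suc (count _ (P? ∩? (_≢? f fz)))            ≡⟨ count-remove P? (Q⇒Pf fz q) ⟨
  count _ P?                                  ∎
  where
  open ℕₚ.≤-Reasoning
  fs≢fz : ∀ {z : Fin N} → fs z ≢ fz
  fs≢fz ()

≤-≤-+-≡⇒≡ : ∀ {a b c d} → a ≤ℕ c → b ≤ℕ d → a + b ≡ c + d → a ≡ c
≤-≤-+-≡⇒≡ {a} {b} {c} {d} a≤c b≤d a+b≡c+d = ℕₚ.≤-antisym a≤c (ℕₚ.+-cancelʳ-≤ d c a (begin
  c + d ≡⟨ a+b≡c+d ⟨
  a + b ≤⟨ ℕₚ.+-monoʳ-≤ a b≤d ⟩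
  a + d ∎))
  where open ℕₚ.≤-Reasoning

count-<-injective : ∀ {N} {s : Fin N → Fin N} → Injective _≡_ _≡_ s → (t : Fin N) →
  count (λ z → s z < t) (λ z → s z Finₚ.<? t) ≡ toℕ t
count-<-injective {N} {s} s-inj t = begin
  count (λ z → s z < t) (λ z → s z Finₚ.<? t)
    ≡⟨ ≤-≤-+-≡⇒≡ (count-≤-injection (λ z → s z Finₚ.<? t) (Finₚ._<? t) s-inj (λ _ lt → lt))
                 (count-≤-injection (∁? λ z → s z Finₚ.<? t) (∁? (Finₚ._<? t)) s-inj (λ _ nlt → nlt))
                 (trans (count-∁ (λ z → s z Finₚ.<? t)) (sym (count-∁ (Finₚ._<? t)))) ⟩
  count {N} (_< t) (Finₚ._<? t)
    ≡⟨ count-< t ⟩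
  toℕ t ∎
  where open ≡-Reasoning

count-positive⇒least : ∀ {N} {P : Fin N → Set} (P? : Decidable P) → 1 ≤ℕ count P P? →
  Σ (Fin N) λ z → P z × (∀ u → P u → z ≤ u)
count-positive⇒least {suc N} P? pos with P? fz
... | yes p = fz , p , λ _ _ → z≤n
... | no ¬p with count-positive⇒least (P? ∘ fs) pos
...   | z , pz , least = fs z , pz , λ { fz pu → ⊥-elim (¬p pu) ; (fs u) pu → s≤s (least u pu) }

Sat? : ∀ {N v} (σ : Perm N) (ρ : Fin v → Fin N) (φ : Formula v) → Dec (Sat σ ρ φ)
Sat? σ       ρ (x ≐ y)  = ρ x Finₚ.≟ ρ y
Sat? σ       ρ (x <P y) = ρ x Finₚ.<? ρ y
Sat? (s , _) ρ (x <V y) = s (ρ x) Finₚ.<? s (ρ y)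
Sat? σ       ρ ⊤′       = yes tt
Sat? σ       ρ ⊥′       = no λ ()
Sat? σ       ρ (¬′ φ)   = ¬? (Sat? σ ρ φ)
Sat? σ       ρ (φ ∧′ ψ) = Sat? σ ρ φ ×-dec Sat? σ ρ ψ
Sat? σ       ρ (φ ∨′ ψ) = Sat? σ ρ φ ⊎-dec Sat? σ ρ ψ
Sat? σ       ρ (φ ⇒′ ψ) = Sat? σ ρ φ →-dec Sat? σ ρ ψ
Sat? σ       ρ (∃′ φ)   = Finₚ.any? λ a → Sat? σ (extend ρ a) φ
Sat? σ       ρ (∀′ φ)   = Finₚ.all? λ a → Sat? σ (extend ρ a) φ

lift : ∀ {v w} → (Fin v → Fin w) → Fin (suc v) → Fin (suc w)
lift f fz     = fz
lift f (fs i) = fs (f i)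

rename : ∀ {v w} → (Fin v → Fin w) → Formula v → Formula w
rename f (x ≐ y)  = f x ≐ f y
rename f (x <P y) = f x <P f y
rename f (x <V y) = f x <V f y
rename f ⊤′       = ⊤′
rename f ⊥′       = ⊥′
rename f (¬′ φ)   = ¬′ rename f φ
rename f (φ ∧′ ψ) = rename f φ ∧′ rename f ψ
rename f (φ ∨′ ψ) = rename f φ ∨′ rename f ψ
rename f (φ ⇒′ ψ) = rename f φ ⇒′ rename f ψ
rename f (∃′ φ)   = ∃′ (rename (lift f) φ)
rename f (∀′ φ)   = ∀′ (rename (lift f) φ)

∃-⇔ : ∀ {I : Set} {A B : I → Set} → (∀ i → A i ⇔ B i) → Σ I A ⇔ Σ I B
∃-⇔ A⇔B = Σ-⇔ (↠-id _) (A⇔B _)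

∀-⇔ : ∀ {I : Set} {A B : I → Set} → (∀ i → A i ⇔ B i) → ((i : I) → A i) ⇔ ((i : I) → B i)
∀-⇔ A⇔B = mk⇔ (λ f i → to (A⇔B i) (f i)) (λ g i → from (A⇔B i) (g i))

extend-lift : ∀ {N v w} {f : Fin v → Fin w} {ρ : Fin w → Fin N} {ρ′ : Fin v → Fin N} →
  (∀ i → ρ (f i) ≡ ρ′ i) → ∀ a i → extend ρ a (lift f i) ≡ extend ρ′ a i
extend-lift ρf≗ρ′ a fz     = refl
extend-lift ρf≗ρ′ a (fs i) = ρf≗ρ′ i

Sat-rename : ∀ {N v w} (σ : Perm N) (f : Fin v → Fin w) {ρ : Fin w → Fin N} {ρ′ : Fin v → Fin N} →
  (∀ i → ρ (f i) ≡ ρ′ i) → (φ : Formula v) → Sat σ ρ (rename f φ) ⇔ Sat σ ρ′ φ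
Sat-rename σ       f ρf≗ρ′ (x ≐ y)  rewrite ρf≗ρ′ x | ρf≗ρ′ y = ⇔-id _
Sat-rename σ       f ρf≗ρ′ (x <P y) rewrite ρf≗ρ′ x | ρf≗ρ′ y = ⇔-id _
Sat-rename (s , _) f ρf≗ρ′ (x <V y) rewrite ρf≗ρ′ x | ρf≗ρ′ y = ⇔-id _
Sat-rename σ       f ρf≗ρ′ ⊤′       = ⇔-id _
Sat-rename σ       f ρf≗ρ′ ⊥′       = ⇔-id _
Sat-rename σ       f ρf≗ρ′ (¬′ φ)   = ¬-cong-⇔ (Sat-rename σ f ρf≗ρ′ φ)
Sat-rename σ       f ρf≗ρ′ (φ ∧′ ψ) = Sat-rename σ f ρf≗ρ′ φ ×-⇔ Sat-rename σ f ρf≗ρ′ ψ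
Sat-rename σ       f ρf≗ρ′ (φ ∨′ ψ) = Sat-rename σ f ρf≗ρ′ φ ⊎-⇔ Sat-rename σ f ρf≗ρ′ ψ
Sat-rename σ       f ρf≗ρ′ (φ ⇒′ ψ) = →-cong-⇔ (Sat-rename σ f ρf≗ρ′ φ) (Sat-rename σ f ρf≗ρ′ ψ)
Sat-rename σ       f ρf≗ρ′ (∃′ φ)   = ∃-⇔ λ a → Sat-rename σ (lift f) (extend-lift ρf≗ρ′ a) φ
Sat-rename σ       f ρf≗ρ′ (∀′ φ)   = ∀-⇔ λ a → Sat-rename σ (lift f) (extend-lift ρf≗ρ′ a) φ

#Sat : ∀ {N v} (σ : Perm N) (ρ : Fin v → Fin N) (ψ : Formula (suc v)) → ℕ
#Sat σ ρ ψ = count (λ z → Sat σ (extend ρ z) ψ) (λ z → Sat? σ (extend ρ z) ψ)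

-- ψ for a new witness (variable 0) that differs from the previous one (variable 1)
freshOf : ∀ {v} → Formula (suc v) → Formula (suc (suc v))
freshOf ψ = rename (lift fs) ψ ∧′ (¬′ (fz ≐ fs fz))

atLeast : ∀ {v} → ℕ → Formula (suc v) → Formula v
atLeast zero    ψ = ⊤′
atLeast (suc j) ψ = ∃′ (ψ ∧′ atLeast j (freshOf ψ))

exactly : ∀ {v} → ℕ → Formula (suc v) → Formula v
exactly j ψ = atLeast j ψ ∧′ (¬′ atLeast (suc j) ψ)

#Sat-remove : ∀ {N v} (σ : Perm N) (ρ : Fin v → Fin N) (ψ : Formula (suc v)) {z : Fin N} →
  Sat σ (extend ρ z) ψ → #Sat σ ρ ψ ≡ suc (#Sat σ (extend ρ z) (freshOf ψ))
#Sat-remove σ ρ ψ {z} ψz = trans (count-remove (λ u → Sat? σ (extend ρ u) ψ) ψz)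
  (cong suc (count-cong _ (λ w → Sat? σ (extend (extend ρ z) w) (freshOf ψ)) λ w →
    ⇔-sym (Sat-rename σ (lift fs) (λ { fz → refl ; (fs i) → refl }) ψ) ×-⇔ ⇔-id _))

Sat-atLeast : ∀ {N v} (σ : Perm N) (ρ : Fin v → Fin N) (j : ℕ) (ψ : Formula (suc v)) →
  Sat σ ρ (atLeast j ψ) ⇔ j ≤ℕ #Sat σ ρ ψ
Sat-atLeast σ ρ zero    ψ = mk⇔ (λ _ → z≤n) (λ _ → tt)
Sat-atLeast σ ρ (suc j) ψ = mk⇔ ⇒ ⇐
  where
  ⇒ : Sat σ ρ (atLeast (suc j) ψ) → suc j ≤ℕ #Sat σ ρ ψ
  ⇒ (z , ψz , rest) rewrite #Sat-remove σ ρ ψ ψz = s≤s (to (Sat-atLeast σ (extend ρ z) j (freshOf ψ)) rest)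
  ⇐ : suc j ≤ℕ #Sat σ ρ ψ → Sat σ ρ (atLeast (suc j) ψ)
  ⇐ j<# with count-positive⇒least (λ z → Sat? σ (extend ρ z) ψ) (ℕₚ.≤-trans (s≤s z≤n) j<#)
  ... | z , ψz , _ = z , ψz , from (Sat-atLeast σ (extend ρ z) j (freshOf ψ))
                                (ℕ.s≤s⁻¹ (subst (suc j ≤ℕ_) (#Sat-remove σ ρ ψ ψz) j<#))

Sat-exactly : ∀ {N v} (σ : Perm N) (ρ : Fin v → Fin N) (j : ℕ) (ψ : Formula (suc v)) →
  Sat σ ρ (exactly j ψ) ⇔ #Sat σ ρ ψ ≡ j
Sat-exactly σ ρ j ψ = mk⇔
  (λ (≥j , ≱j+1) → ℕₚ.≤-antisym (ℕₚ.≮⇒≥ (≱j+1 ∘ from (atLeast′ (suc j)))) (to (atLeast′ j) ≥j))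
  (λ { refl → from (atLeast′ j) ℕₚ.≤-refl , ℕₚ.<-irrefl refl ∘ to (atLeast′ (suc j)) })
  where atLeast′ = λ i → Sat-atLeast σ ρ i ψ

-- Monotone chains (Erdős–Szekeres)

record Chain {N} (R : Fin N → Fin N → Set) (S : Fin N → Set) (l : ℕ) : Set where
  field
    point      : Fin l → Fin N
    point∈S    : ∀ i → S (point i)
    increasing : ∀ {i j} → i < j → point i < point j
    related    : ∀ {i j} → i < j → R (point i) (point j)

open Chain

chain-weaken : ∀ {N} {R : Fin N → Fin N → Set} {S S′ : Fin N → Set} {l} →
  (∀ {z} → S z → S′ z) → Chain R S l → Chain R S′ l
chain-weaken S⇒S′ c = record
  { point = point c ; point∈S = S⇒S′ ∘ point∈S c ; increasing = increasing c ; related = related c }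

chain-[] : ∀ {N} {R : Fin N → Fin N → Set} {S : Fin N → Set} → Chain R S 0
chain-[] = record { point = λ () ; point∈S = λ () ; increasing = λ {} ; related = λ {} }

chain-∷ : ∀ {N} {R : Fin N → Fin N → Set} {S : Fin N → Set} {l} (z : Fin N) → S z →
  (c : Chain R S l) → (∀ i → z < point c i × R z (point c i)) → Chain R S (suc l)
chain-∷ {N} {R} {S} {l} z Sz c z-below = record
  { point = g ; point∈S = g∈S ; increasing = increasing′ ; related = related′ }
  where
  g : Fin (suc l) → Fin N
  g fz     = z
  g (fs i) = point c i
  g∈S : ∀ i → S (g i)
  g∈S fz     = Sz
  g∈S (fs i) = point∈S c i
  increasing′ : ∀ {i j} → i < j → g i < g j
  increasing′ {fz}   {fs j} _         = proj₁ (z-below j)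
  increasing′ {fs i} {fs j} (s≤s i<j) = increasing c i<j
  related′ : ∀ {i j} → i < j → R (g i) (g j)
  related′ {fz}   {fs j} _         = proj₂ (z-below j)
  related′ {fs i} {fs j} (s≤s i<j) = related c i<j

esBound : ℕ → ℕ → ℕ
esBound zero    m       = 0
esBound (suc k) zero    = 0
esBound (suc k) (suc m) = suc (esBound (suc k) m + esBound k (suc m))

Ascent Descent : ∀ {N} → (Fin N → Fin N) → Fin N → Fin N → Set
Ascent  s a b = s a < s b
Descent s a b = s b < s a

module _ {N} (s : Fin N → Fin N) (s-inj : Injective _≡_ _≡_ s) where

  erdős-szekeres : ∀ k m {S : Fin N → Set} (S? : Decidable S) → esBound k m ≤ℕ count S S? →
    Chain (Descent s) S k ⊎ Chain (Ascent s) S m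
  erdős-szekeres zero    m       S? _ = inj₁ chain-[]
  erdős-szekeres (suc k) zero    S? _ = inj₂ chain-[]
  erdős-szekeres (suc k) (suc m) {S} S? bound
    with z₀ , Sz₀ , z₀-least ← count-positive⇒least S? (ℕₚ.≤-trans (s≤s z≤n) bound) = result
    where
    Up Down : Fin N → Set
    Up   z = S z × z₀ < z × s z₀ < s z
    Down z = S z × z₀ < z × s z < s z₀
    Up? : Decidable Up
    Up? z = S? z ×-dec z₀ Finₚ.<? z ×-dec s z₀ Finₚ.<? s z
    Down? : Decidable Down
    Down? z = S? z ×-dec z₀ Finₚ.<? z ×-dec s z Finₚ.<? s z₀

    after-z₀ : ∀ {z} → S z → z ≢ z₀ → z₀ < z
    after-z₀ Sz z≢z₀ = Finₚ.≤∧≢⇒< (z₀-least _ Sz) (z≢z₀ ∘ sym)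

    count-S : count S S? ≡ suc (count Up Up? + count Down Down?)
    count-S = begin
      count S S?
        ≡⟨ count-remove S? Sz₀ ⟩
      suc (count (S ∩ (_≢ z₀)) S′?)
        ≡⟨ cong suc (count-split S′? (λ z → s z₀ Finₚ.<? s z)) ⟩
      suc (count _ (S′? ∩? λ z → s z₀ Finₚ.<? s z) + count _ (S′? ∩? ∁? λ z → s z₀ Finₚ.<? s z))
        ≡⟨ cong suc (cong₂ _+_ (count-cong _ Up? λ z → mk⇔
               (λ ((Sz , z≢z₀) , up) → Sz , after-z₀ Sz z≢z₀ , up)
               (λ (Sz , z₀<z , up) → (Sz , Finₚ.<⇒≢ z₀<z ∘ sym) , up))
             (count-cong _ Down? λ z → mk⇔
               (λ ((Sz , z≢z₀) , ¬up) → Sz , after-z₀ Sz z≢z₀ ,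
                  Finₚ.≤∧≢⇒< (ℕₚ.≮⇒≥ ¬up) (z≢z₀ ∘ s-inj))
               (λ (Sz , z₀<z , down) → (Sz , Finₚ.<⇒≢ z₀<z ∘ sym) , Finₚ.<-asym down))) ⟩
      suc (count Up Up? + count Down Down?) ∎
      where
      open ≡-Reasoning
      S′? = S? ∩? (_≢? z₀)

    result : Chain (Descent s) S (suc k) ⊎ Chain (Ascent s) S (suc m)
    result with esBound (suc k) m ℕₚ.≤? count Up Up?
    ... | yes up-large with erdős-szekeres (suc k) m Up? up-large
    ...   | inj₁ desc = inj₁ (chain-weaken proj₁ desc)
    ...   | inj₂ asc  = inj₂ (chain-∷ z₀ Sz₀ (chain-weaken proj₁ asc) (proj₂ ∘ point∈S asc))
    result | no up-small with erdős-szekeres k (suc m) Down? down-large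
      where
      down-large : esBound k (suc m) ≤ℕ count Down Down?
      down-large = ℕₚ.+-cancelˡ-≤ (esBound (suc k) m) _ _ (ℕₚ.≤-trans
        (ℕ.s≤s⁻¹ (subst (_ ≤ℕ_) count-S bound))
        (ℕₚ.+-monoˡ-≤ _ (ℕₚ.<⇒≤ (ℕₚ.≰⇒> up-small))))
    ... | inj₁ desc = inj₁ (chain-∷ z₀ Sz₀ (chain-weaken proj₁ desc) (proj₂ ∘ point∈S desc))
    ... | inj₂ asc  = inj₂ (chain-weaken proj₁ asc)

-- The patterns δ_k and ι_m ⊖ ι_n

<-⇔-increasing : ∀ {l M} {g : Fin l → Fin M} → (∀ {i j} → i < j → g i < g j) →
  ∀ i j → g i < g j ⇔ i < j
<-⇔-increasing {g = g} g-inc i j = mk⇔ reflect g-inc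
  where
  reflect : g i < g j → i < j
  reflect gi<gj with Finₚ.<-cmp i j
  ... | tri< i<j _ _ = i<j
  ... | tri≈ _ refl _ = ⊥-elim (Finₚ.<-irrefl refl gi<gj)
  ... | tri> _ _ j<i = ⊥-elim (Finₚ.<-asym gi<gj (g-inc j<i))

<-⇔-decreasing : ∀ {l M} {g : Fin l → Fin M} → (∀ {i j} → i < j → g j < g i) →
  ∀ i j → g i < g j ⇔ j < i
<-⇔-decreasing {g = g} g-dec i j = mk⇔ reflect g-dec
  where
  reflect : g i < g j → j < i
  reflect gi<gj with Finₚ.<-cmp i j
  ... | tri< i<j _ _ = ⊥-elim (Finₚ.<-asym gi<gj (g-dec i<j))
  ... | tri≈ _ refl _ = ⊥-elim (Finₚ.<-irrefl refl gi<gj)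
  ... | tri> _ _ j<i = j<i

retraction⇒injective : ∀ {A B : Set} {f : A → B} (g : B → A) → (∀ x → g (f x) ≡ x) → Injective _≡_ _≡_ f
retraction⇒injective g g∘f≗id {x} {y} fx≡fy = trans (sym (g∘f≗id x)) (trans (cong g fx≡fy) (g∘f≗id y))

opposite-injective : ∀ {k} → Injective _≡_ _≡_ (opposite {k})
opposite-injective = retraction⇒injective opposite Finₚ.opposite-involutive

opposite-decreasing : ∀ {k} {i j : Fin k} → i < j → opposite j < opposite i
opposite-decreasing {k} {i} {j} i<j rewrite Finₚ.opposite-prop i | Finₚ.opposite-prop j =
  ℕₚ.∸-monoʳ-< (s≤s i<j) (Finₚ.toℕ<n j)

δ : ∀ k → Perm k
δ k = opposite , opposite-injective

δ-isDecreasing : ∀ k → IsDecreasing k (δ k)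
δ-isDecreasing k i = trans (Finₚ.opposite-prop i) (sym (ℕₚ.∸-+-assoc k 1 (toℕ i)))

data Block (m n : ℕ) : Fin (m + n) → Set where
  first  : (a : Fin m) → Block m n (a ↑ˡ n)
  second : (b : Fin n) → Block m n (m ↑ʳ b)

block : ∀ m n (i : Fin (m + n)) → Block m n i
block m n i with splitAt m i in eq
... | inj₁ a = subst (Block m n) (Finₚ.splitAt⁻¹-↑ˡ eq) (first a)
... | inj₂ b = subst (Block m n) (Finₚ.splitAt⁻¹-↑ʳ eq) (second b)

ι⊖ι-fun : ∀ m n → Fin (m + n) → Fin (m + n)
ι⊖ι-fun m n i = Fin.cast (ℕₚ.+-comm n m) (join n m (swap (splitAt m i)))

ι⊖ι-injective : ∀ m n → Injective _≡_ _≡_ (ι⊖ι-fun m n)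
ι⊖ι-injective m n = retraction⇒injective (join m n ∘ swap ∘ splitAt n ∘ Fin.cast (ℕₚ.+-comm m n)) λ i → begin
  join m n (swap (splitAt n (Fin.cast m+n≡n+m (Fin.cast n+m≡m+n (join n m (swap (splitAt m i)))))))
    ≡⟨ cong (join m n ∘ swap ∘ splitAt n) (Finₚ.cast-involutive m+n≡n+m n+m≡m+n _) ⟩
  join m n (swap (splitAt n (join n m (swap (splitAt m i)))))
    ≡⟨ cong (join m n ∘ swap) (Finₚ.splitAt-join n m (swap (splitAt m i))) ⟩
  join m n (swap (swap (splitAt m i)))
    ≡⟨ cong (join m n) (swap-involutive (splitAt m i)) ⟩
  join m n (splitAt m i)
    ≡⟨ Finₚ.join-splitAt m n i ⟩
  i ∎
  where
  open ≡-Reasoning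
  m+n≡n+m = ℕₚ.+-comm m n
  n+m≡m+n = ℕₚ.+-comm n m

ι⊖ι : ∀ m n → Perm (m + n)
ι⊖ι m n = ι⊖ι-fun m n , ι⊖ι-injective m n

toℕ-ι⊖ι-first : ∀ m n (a : Fin m) → toℕ (ι⊖ι-fun m n (a ↑ˡ n)) ≡ n + toℕ a
toℕ-ι⊖ι-first m n a rewrite Finₚ.toℕ-cast (ℕₚ.+-comm n m) (join n m (swap (splitAt m (a ↑ˡ n))))
                          | Finₚ.splitAt-↑ˡ m a n = Finₚ.toℕ-↑ʳ n a

toℕ-ι⊖ι-second : ∀ m n (b : Fin n) → toℕ (ι⊖ι-fun m n (m ↑ʳ b)) ≡ toℕ b
toℕ-ι⊖ι-second m n b rewrite Finₚ.toℕ-cast (ℕₚ.+-comm n m) (join n m (swap (splitAt m (m ↑ʳ b))))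
                           | Finₚ.splitAt-↑ʳ m n b = Finₚ.toℕ-↑ˡ b m

ι⊖ι-isIotaMinusIota : ∀ m n → IsIotaMinusIota m n (ι⊖ι m n)
ι⊖ι-isIotaMinusIota m n i with block m n i
... | first a rewrite toℕ-ι⊖ι-first m n a | Finₚ.toℕ-↑ˡ a n
  with toℕ a <ᵇ m | ℕₚ.<ᵇ-reflects-< (toℕ a) m
...   | true  | _       = refl
...   | false | ofⁿ a≮m = ⊥-elim (a≮m (Finₚ.toℕ<n a))
ι⊖ι-isIotaMinusIota m n i | second b rewrite toℕ-ι⊖ι-second m n b | Finₚ.toℕ-↑ʳ m b
  with m + toℕ b <ᵇ m | ℕₚ.<ᵇ-reflects-< (m + toℕ b) m
...   | false | _           = sym (ℕₚ.m+n∸m≡n m (toℕ b))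
...   | true  | ofʸ m+b<m = ⊥-elim (ℕₚ.m+n≮m m (toℕ b) m+b<m)

toℕ-<-⇔ : ∀ {k l} {x : Fin k} {y : Fin l} {p q} → toℕ x ≡ p → toℕ y ≡ q → x < y ⇔ p <ℕ q
toℕ-<-⇔ refl refl = ⇔-id _

module _ {N} (σ : Perm N) {m n} {S₁ S₂ : Fin N → Set}
  (c₁ : Chain (Ascent (proj₁ σ)) S₁ m) (c₂ : Chain (Ascent (proj₁ σ)) S₂ n)
  (left-above : ∀ {z₁ z₂} → S₁ z₁ → S₂ z₂ → z₁ < z₂ × proj₁ σ z₂ < proj₁ σ z₁) where

  private
    s = proj₁ σ

    pick : ∀ {i} → Block m n i → Fin N
    pick (first a)  = point c₁ a
    pick (second b) = point c₂ b

    embed : Fin (m + n) → Fin N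
    embed i = pick (block m n i)

    embed-increasing : ∀ i j → i < j → embed i < embed j
    embed-increasing i j i<j with block m n i | block m n j
    ... | first a  | first a′ = increasing c₁ (to (toℕ-<-⇔ (Finₚ.toℕ-↑ˡ a n) (Finₚ.toℕ-↑ˡ a′ n)) i<j)
    ... | first a  | second b = proj₁ (left-above (point∈S c₁ a) (point∈S c₂ b))
    ... | second b | first a  = ⊥-elim (ℕₚ.m+n≮m m (toℕ b) (ℕₚ.<-trans
          (to (toℕ-<-⇔ (Finₚ.toℕ-↑ʳ m b) (Finₚ.toℕ-↑ˡ a n)) i<j) (Finₚ.toℕ<n a)))
    ... | second b | second b′ = increasing c₂
          (ℕₚ.+-cancelˡ-< m _ _ (to (toℕ-<-⇔ (Finₚ.toℕ-↑ʳ m b) (Finₚ.toℕ-↑ʳ m b′)) i<j))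

    embed-values : ∀ i j → ι⊖ι-fun m n i < ι⊖ι-fun m n j ⇔ s (embed i) < s (embed j)
    embed-values i j with block m n i | block m n j
    ... | first a  | first a′ =
      ⇔-sym (<-⇔-increasing (related c₁) a a′)
        ⇔-∘ (mk⇔ (ℕₚ.+-cancelˡ-< n _ _) (ℕₚ.+-monoʳ-< n)
        ⇔-∘ toℕ-<-⇔ (toℕ-ι⊖ι-first m n a) (toℕ-ι⊖ι-first m n a′))
    ... | first a  | second b = mk⇔
      (λ n+a<b → ⊥-elim (ℕₚ.m+n≮m n (toℕ a) (ℕₚ.<-trans
                  (to (toℕ-<-⇔ (toℕ-ι⊖ι-first m n a) (toℕ-ι⊖ι-second m n b)) n+a<b) (Finₚ.toℕ<n b))))
      (λ up → ⊥-elim (Finₚ.<-asym up (proj₂ (left-above (point∈S c₁ a) (point∈S c₂ b)))))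
    ... | second b | first a  = mk⇔
      (λ _ → proj₂ (left-above (point∈S c₁ a) (point∈S c₂ b)))
      (λ _ → from (toℕ-<-⇔ (toℕ-ι⊖ι-second m n b) (toℕ-ι⊖ι-first m n a))
               (ℕₚ.<-≤-trans (Finₚ.toℕ<n b) (ℕₚ.m≤m+n n (toℕ a))))
    ... | second b | second b′ =
      ⇔-sym (<-⇔-increasing (related c₂) b b′) ⇔-∘ toℕ-<-⇔ (toℕ-ι⊖ι-second m n b) (toℕ-ι⊖ι-second m n b′)

  ascents-left-above⇒ι⊖ι≼ : ι⊖ι m n ≼ σ
  ascents-left-above⇒ι⊖ι≼ = embed , embed-increasing , embed-values

module _ (C : PermClass) (C-closed : IsPermClass C) {N} (σ : Perm N) (σ∈C : C N σ) where

  descents⇒δ∈C : ∀ {S k} → Chain (Descent (proj₁ σ)) S k → k ∈δ C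
  descents⇒δ∈C {k = k} c = δ k , δ-isDecreasing k , C-closed (δ k) σ δ≼σ σ∈C
    where
    δ≼σ : δ k ≼ σ
    δ≼σ = point c , (λ _ _ → increasing c) , λ i j →
      ⇔-sym (<-⇔-decreasing (related c) i j) ⇔-∘ <-⇔-decreasing opposite-decreasing i j

  ascents-left-above⇒ι⊖ι∈C : ∀ {m n S₁ S₂} →
    (c₁ : Chain (Ascent (proj₁ σ)) S₁ m) (c₂ : Chain (Ascent (proj₁ σ)) S₂ n) →
    (∀ {z₁ z₂} → S₁ z₁ → S₂ z₂ → z₁ < z₂ × proj₁ σ z₂ < proj₁ σ z₁) → m , n ∈⊖ C
  ascents-left-above⇒ι⊖ι∈C {m} {n} c₁ c₂ left-above =
    ι⊖ι m n , ι⊖ι-isIotaMinusIota m n , C-closed (ι⊖ι m n) σ (ascents-left-above⇒ι⊖ι≼ σ c₁ c₂ left-above) σ∈C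

-- (2) ⇒ (1)

leftNotBelow belowNotLeft : Fin 2 → Fin 2 → Formula 3
leftNotBelow a b = (fz <P fs b) ∧′ (¬′ (fz <V fs a))
belowNotLeft a b = (fz <V fs a) ∧′ (¬′ (fz <P fs b))

balanced : ℕ → Fin 2 → Fin 2 → Formula 2
balanced j a b = exactly j (leftNotBelow a b) ∧′ exactly j (belowNotLeft a b)

balancedUpTo : ℕ → Fin 2 → Fin 2 → Formula 2
balancedUpTo zero    a b = balanced zero a b
balancedUpTo (suc J) a b = balanced (suc J) a b ∨′ balancedUpTo J a b

module _ {N} (σ : Perm N) (ρ : Fin 2 → Fin N) (a b : Fin 2) where

  private
    s = proj₁ σ
    #₁ = #Sat σ ρ (leftNotBelow a b)
    #₂ = #Sat σ ρ (belowNotLeft a b)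

  maps-to⇔balanced : s (ρ a) ≡ ρ b ⇔ #₁ ≡ #₂
  maps-to⇔balanced = mk⇔
    (λ sa≡b → ℕₚ.+-cancelˡ-≡ common _ _ (trans (sym position-b) (trans (cong toℕ (sym sa≡b)) value-a)))
    (λ #₁≡#₂ → Finₚ.toℕ-injective (trans value-a (trans (cong (common +_) (sym #₁≡#₂)) (sym position-b))))
    where
    Left? : Decidable λ z → z < ρ b
    Left? z = z Finₚ.<? ρ b
    Below? : Decidable λ z → s z < s (ρ a)
    Below? z = s z Finₚ.<? s (ρ a)
    common = count _ (Left? ∩? Below?)
    position-b : toℕ (ρ b) ≡ common + #₁
    position-b = trans (sym (count-< (ρ b))) (count-split Left? Below?)
    value-a : toℕ (s (ρ a)) ≡ common + #₂
    value-a = begin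
      toℕ (s (ρ a))
        ≡⟨ count-<-injective (proj₂ σ) (s (ρ a)) ⟨
      count _ Below?
        ≡⟨ count-split Below? Left? ⟩
      count _ (Below? ∩? Left?) + #₂
        ≡⟨ cong (_+ #₂) (count-cong (Below? ∩? Left?) (Left? ∩? Below?) λ _ → mk⇔ ×-swap ×-swap) ⟩
      common + #₂ ∎
      where open ≡-Reasoning

  Sat-balanced : ∀ j → Sat σ ρ (balanced j a b) ⇔ (#₁ ≡ j × #₂ ≡ j)
  Sat-balanced j = Sat-exactly σ ρ j (leftNotBelow a b) ×-⇔ Sat-exactly σ ρ j (belowNotLeft a b)

  Sat-balancedUpTo : ∀ J → Sat σ ρ (balancedUpTo J a b) ⇔ (#₁ ≡ #₂ × #₁ ≤ℕ J)
  Sat-balancedUpTo J = mk⇔ (⇒ J) (⇐ J)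
    where
    exact : ∀ {j} → #₁ ≡ j × #₂ ≡ j → #₁ ≡ #₂ × #₁ ≤ℕ j
    exact (#₁≡j , #₂≡j) = trans #₁≡j (sym #₂≡j) , ℕₚ.≤-reflexive #₁≡j
    ⇒ : ∀ J → Sat σ ρ (balancedUpTo J a b) → #₁ ≡ #₂ × #₁ ≤ℕ J
    ⇒ zero    bal            = exact (to (Sat-balanced 0) bal)
    ⇒ (suc J) (inj₁ bal)     = exact (to (Sat-balanced (suc J)) bal)
    ⇒ (suc J) (inj₂ smaller) = let (#₁≡#₂ , #₁≤J) = ⇒ J smaller in #₁≡#₂ , ℕₚ.m≤n⇒m≤1+n #₁≤J
    ⇐ : ∀ J → #₁ ≡ #₂ × #₁ ≤ℕ J → Sat σ ρ (balancedUpTo J a b)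
    ⇐ zero (#₁≡#₂ , #₁≤0) = from (Sat-balanced 0) (#₁≡0 , trans (sym #₁≡#₂) #₁≡0)
      where #₁≡0 = ℕₚ.n≤0⇒n≡0 #₁≤0
    ⇐ (suc J) (#₁≡#₂ , #₁≤1+J) with #₁ ℕ.≟ suc J
    ... | yes #₁≡1+J = inj₁ (from (Sat-balanced (suc J)) (#₁≡1+J , trans (sym #₁≡#₂) #₁≡1+J))
    ... | no  #₁≢1+J = inj₂ (⇐ J (#₁≡#₂ , ℕ.s≤s⁻¹ (ℕₚ.≤∧≢⇒< #₁≤1+J #₁≢1+J)))

  balanced⇒bounded : ∀ {C} → IsPermClass C → C N σ → ∀ {k m n} → ¬ k ∈δ C → ¬ m , n ∈⊖ C →
    #₁ ≡ #₂ → #₁ ≤ℕ esBound k m + esBound k n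
  balanced⇒bounded {C} C-closed σ∈C {k} {m} {n} δk∉C ι⊖ι∉C #₁≡#₂
    with #₁ ℕₚ.≤? esBound k m + esBound k n
  ... | yes bounded = bounded
  ... | no unbounded
    with erdős-szekeres s (proj₂ σ) k m (λ z → Sat? σ (extend ρ z) (leftNotBelow a b)) large₁
       | erdős-szekeres s (proj₂ σ) k n (λ z → Sat? σ (extend ρ z) (belowNotLeft a b)) large₂
    where
    large : esBound k m + esBound k n ≤ℕ #₁
    large = ℕₚ.<⇒≤ (ℕₚ.≰⇒> unbounded)
    large₁ : esBound k m ≤ℕ #₁
    large₁ = ℕₚ.≤-trans (ℕₚ.m≤m+n _ _) large
    large₂ : esBound k n ≤ℕ #₂
    large₂ = subst (_ ≤ℕ_) #₁≡#₂ (ℕₚ.≤-trans (ℕₚ.m≤n+m _ _) large)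
  ... | inj₁ desc | _         = ⊥-elim (δk∉C (descents⇒δ∈C C C-closed σ σ∈C desc))
  ... | inj₂ _    | inj₁ desc = ⊥-elim (δk∉C (descents⇒δ∈C C C-closed σ σ∈C desc))
  ... | inj₂ asc₁ | inj₂ asc₂ = ⊥-elim (ι⊖ι∉C (ascents-left-above⇒ι⊖ι∈C C C-closed σ σ∈C asc₁ asc₂ left-above))
    where
    left-above : ∀ {z₁ z₂} → Sat σ (extend ρ z₁) (leftNotBelow a b) → Sat σ (extend ρ z₂) (belowNotLeft a b) →
      z₁ < z₂ × s z₂ < s z₁
    left-above (z₁<b , z₁≮a) (z₂<a , z₂≮b) =
      ℕₚ.<-≤-trans z₁<b (ℕₚ.≮⇒≥ z₂≮b) , ℕₚ.<-≤-trans z₂<a (ℕₚ.≮⇒≥ z₁≮a)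

module _ (C : PermClass) (C-closed : IsPermClass C) {k m n : ℕ}
         (δk∉C : ¬ k ∈δ C) (ι⊖ι∉C : ¬ m , n ∈⊖ C) where

  mapsTo : Fin 2 → Fin 2 → Formula 2
  mapsTo = balancedUpTo (esBound k m + esBound k n)

  Sat-mapsTo : ∀ {N} (σ : Perm N) → C N σ → (ρ : Fin 2 → Fin N) (a b : Fin 2) →
    Sat σ ρ (mapsTo a b) ⇔ proj₁ σ (ρ a) ≡ ρ b
  Sat-mapsTo σ σ∈C ρ a b = begin
    Sat σ ρ (mapsTo a b)    ≈⟨ Sat-balancedUpTo σ ρ a b _ ⟩
    (#₁ ≡ #₂ × #₁ ≤ℕ bound) ≈⟨ mk⇔ proj₁ (λ #₁≡#₂ → #₁≡#₂ , bounded #₁≡#₂) ⟩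
    #₁ ≡ #₂                 ≈⟨ maps-to⇔balanced σ ρ a b ⟨
    proj₁ σ (ρ a) ≡ ρ b     ∎
    where
    open ⇔-Reasoning
    bound = esBound k m + esBound k n
    #₁ = #Sat σ ρ (leftNotBelow a b)
    #₂ = #Sat σ ρ (belowNotLeft a b)
    bounded = balanced⇒bounded σ ρ a b C-closed σ∈C δk∉C ι⊖ι∉C

  transposition : Formula 2
  transposition = (¬′ (fz ≐ fs fz)) ∧′ (mapsTo fz (fs fz) ∧′ mapsTo (fs fz) fz)

  Sat-transposition : ∀ {N} (σ : Perm N) → C N σ → (a b : Fin N) →
    Sat σ (pair a b) transposition ⇔ IsTransposition σ a b
  Sat-transposition σ σ∈C a b =
    ⇔-id _ ×-⇔ (Sat-mapsTo σ σ∈C (pair a b) fz (fs fz) ×-⇔ Sat-mapsTo σ σ∈C (pair a b) (fs fz) fz)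

-- (1) ⇒ (2)

data SameGap (t a b a′ b′ : ℕ) : Set where
  exactʳ : ∀ d → b ≡ a + d → b′ ≡ a′ + d → SameGap t a b a′ b′
  exactˡ : ∀ d → a ≡ b + d → a′ ≡ b′ + d → SameGap t a b a′ b′
  farʳ   : a + t ≤ℕ b → a′ + t ≤ℕ b′ → SameGap t a b a′ b′
  farˡ   : b + t ≤ℕ a → b′ + t ≤ℕ a′ → SameGap t a b a′ b′

SameGap-swap : ∀ {t a b a′ b′} → SameGap t a b a′ b′ → SameGap t b a b′ a′
SameGap-swap (exactʳ d eq eq′) = exactˡ d eq eq′
SameGap-swap (exactˡ d eq eq′) = exactʳ d eq eq′
SameGap-swap (farʳ far far′)   = farˡ far far′
SameGap-swap (farˡ far far′)   = farʳ far far′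

SameGap-sym : ∀ {t a b a′ b′} → SameGap t a b a′ b′ → SameGap t a′ b′ a b
SameGap-sym (exactʳ d eq eq′) = exactʳ d eq′ eq
SameGap-sym (exactˡ d eq eq′) = exactˡ d eq′ eq
SameGap-sym (farʳ far far′)   = farʳ far′ far
SameGap-sym (farˡ far far′)   = farˡ far′ far

SameGap-mono : ∀ {t u a b a′ b′} → u ≤ℕ t → SameGap t a b a′ b′ → SameGap u a b a′ b′
SameGap-mono u≤t (exactʳ d eq eq′) = exactʳ d eq eq′
SameGap-mono u≤t (exactˡ d eq eq′) = exactˡ d eq eq′
SameGap-mono u≤t (farʳ far far′)   =
  farʳ (ℕₚ.≤-trans (ℕₚ.+-monoʳ-≤ _ u≤t) far) (ℕₚ.≤-trans (ℕₚ.+-monoʳ-≤ _ u≤t) far′)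
SameGap-mono u≤t (farˡ far far′)   =
  farˡ (ℕₚ.≤-trans (ℕₚ.+-monoʳ-≤ _ u≤t) far) (ℕₚ.≤-trans (ℕₚ.+-monoʳ-≤ _ u≤t) far′)

SameGap-refl : ∀ {t a a′} → SameGap t a a a′ a′
SameGap-refl {a = a} {a′} = exactʳ 0 (sym (ℕₚ.+-identityʳ a)) (sym (ℕₚ.+-identityʳ a′))

exactʳ-cross : ∀ {t a b a′ b′} → a ≤ℕ b → a + b′ ≡ a′ + b → SameGap t a b a′ b′
exactʳ-cross {a = a} {b} {a′} {b′} a≤b eq =
  exactʳ (b ∸ a) (sym (ℕₚ.m+[n∸m]≡n a≤b)) (ℕₚ.+-cancelˡ-≡ a _ _ (begin
  a + b′              ≡⟨ eq ⟩
  a′ + b              ≡⟨ cong (a′ +_) (ℕₚ.m+[n∸m]≡n a≤b) ⟨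
  a′ + (a + (b ∸ a))  ≡⟨ +-left-comm a′ a (b ∸ a) ⟩
  a + (a′ + (b ∸ a))  ∎))
  where open ≡-Reasoning

SameGap-exact : ∀ {t a b a′ b′} → a + b′ ≡ a′ + b → SameGap t a b a′ b′
SameGap-exact {a = a} {b} {a′} {b′} eq with ℕₚ.≤-total a b
... | inj₁ a≤b = exactʳ-cross a≤b eq
... | inj₂ b≤a = SameGap-swap (exactʳ-cross b≤a (trans (ℕₚ.+-comm b a′) (trans (sym eq) (ℕₚ.+-comm a b′))))

SameGap-same : ∀ {t} a b → SameGap t a b a b
SameGap-same a b = SameGap-exact refl

far⇒< : ∀ {t a b} → 1 ≤ℕ t → a + t ≤ℕ b → a <ℕ b
far⇒< {a = a} 1≤t far = ℕₚ.<-≤-trans (ℕₚ.m<m+n a 1≤t) far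

far⇒≰ : ∀ {t a b} → 1 ≤ℕ t → b + t ≤ℕ a → a ≤ℕ b → ⊥
far⇒≰ 1≤t far a≤b = ℕₚ.<⇒≱ (far⇒< 1≤t far) a≤b

SameGap-< : ∀ {t a b a′ b′} → 1 ≤ℕ t → SameGap t a b a′ b′ → a <ℕ b → a′ <ℕ b′
SameGap-< {a = a} 1≤t (exactʳ zero refl refl) a<a+0 = ⊥-elim (ℕₚ.<-irrefl (sym (ℕₚ.+-identityʳ a)) a<a+0)
SameGap-< {a′ = a′} 1≤t (exactʳ (suc d) refl refl) _ = ℕₚ.m<m+n a′ (s≤s z≤n)
SameGap-< {b = b} 1≤t (exactˡ d refl refl) b+d<b = ⊥-elim (ℕₚ.m+n≮m b d b+d<b)
SameGap-< 1≤t (farʳ far far′) _   = far⇒< 1≤t far′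
SameGap-< 1≤t (farˡ far far′) a<b = ⊥-elim (ℕₚ.<-asym a<b (far⇒< 1≤t far))

SameGap-≤ : ∀ {t a b a′ b′} → 1 ≤ℕ t → SameGap t a b a′ b′ → a ≤ℕ b → a′ ≤ℕ b′
SameGap-≤ 1≤t same a≤b = ℕₚ.≮⇒≥ (ℕₚ.≤⇒≯ a≤b ∘ SameGap-< 1≤t (SameGap-swap (SameGap-sym same)))

SameGap-≡ : ∀ {t a b a′ b′} → 1 ≤ℕ t → SameGap t a b a′ b′ → a ≡ b → a′ ≡ b′
SameGap-≡ 1≤t same refl = ℕₚ.≤-antisym (SameGap-≤ 1≤t same ℕₚ.≤-refl) (SameGap-≤ 1≤t (SameGap-swap same) ℕₚ.≤-refl)

SameGap-+≤ : ∀ {t u a b a′ b′} → 1 ≤ℕ t → u ≤ℕ t → SameGap t a b a′ b′ → a + u ≤ℕ b → a′ + u ≤ℕ b′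
SameGap-+≤ {u = u} {a} {a′ = a′} 1≤t u≤t (exactʳ d refl refl) a+u≤a+d =
  ℕₚ.+-monoʳ-≤ a′ (ℕₚ.+-cancelˡ-≤ a u d a+u≤a+d)
SameGap-+≤ {u = u} {b = b} {b′ = b′} 1≤t u≤t (exactˡ d refl refl) b+d+u≤b = ℕₚ.≤-reflexive (begin
  b′ + d + u   ≡⟨ ℕₚ.+-assoc b′ d u ⟩
  b′ + (d + u) ≡⟨ cong (b′ +_) d+u≡0 ⟩
  b′ + 0       ≡⟨ ℕₚ.+-identityʳ b′ ⟩
  b′           ∎)
  where
  open ≡-Reasoning
  d+u≡0 : d + u ≡ 0
  d+u≡0 = ℕₚ.n≤0⇒n≡0 (ℕₚ.+-cancelˡ-≤ b (d + u) 0
            (subst₂ _≤ℕ_ (ℕₚ.+-assoc b d u) (sym (ℕₚ.+-identityʳ b)) b+d+u≤b))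
SameGap-+≤ 1≤t u≤t (farʳ far far′) _ = ℕₚ.≤-trans (ℕₚ.+-monoʳ-≤ _ u≤t) far′
SameGap-+≤ {a = a} 1≤t u≤t (farˡ far far′) a+u≤b = ⊥-elim (far⇒≰ 1≤t far (ℕₚ.m+n≤o⇒m≤o a a+u≤b))

1≤t+t : ∀ {t} → 1 ≤ℕ t → 1 ≤ℕ t + t
1≤t+t {t} 1≤t = ℕₚ.≤-trans 1≤t (ℕₚ.m≤m+n t t)

near-left : ∀ {t q q′ l l′ d} → d <ℕ t → SameGap (t + t) q l q′ l′ → SameGap t (l + d) q (l′ + d) q′
near-left {q = q} {q′} {d = d} d<t (exactʳ d₀ refl refl) =
  exactˡ (d₀ + d) (ℕₚ.+-assoc q d₀ d) (ℕₚ.+-assoc q′ d₀ d)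
near-left {l = l} {l′} {d} d<t (exactˡ d₀ refl refl) =
  SameGap-exact (solve (l ∷ l′ ∷ d ∷ d₀ ∷ []))
near-left {t} {q} {q′} {l} {l′} {d} d<t (farʳ far far′) = farˡ (shrink far) (shrink far′)
  where
  shrink : ∀ {a b} → a + (t + t) ≤ℕ b → a + t ≤ℕ b + d
  shrink {a} {b} far = ℕₚ.≤-trans (ℕₚ.+-monoʳ-≤ a (ℕₚ.m≤m+n t t)) (ℕₚ.≤-trans far (ℕₚ.m≤m+n b d))
near-left {t} {q} {q′} {l} {l′} {d} d<t (farˡ far far′) = farʳ (shrink far) (shrink far′)
  where
  shrink : ∀ {a b} → a + (t + t) ≤ℕ b → a + d + t ≤ℕ b
  shrink {a} {b} far =
    ℕₚ.≤-trans (subst (_≤ℕ a + (t + t)) (sym (ℕₚ.+-assoc a d t)) (ℕₚ.+-monoʳ-≤ a (ℕₚ.+-monoˡ-≤ t (ℕₚ.<⇒≤ d<t)))) far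

near-right : ∀ {t q q′ c c′ e} → e <ℕ t → SameGap (t + t) q (c + e) q′ (c′ + e) → SameGap t c q c′ q′
near-right {q = q} {q′} {c} {c′} {e} e<t (exactʳ d₀ eq eq′) = SameGap-exact (ℕₚ.+-cancelʳ-≡ (e + d₀) _ _ (begin
  c + q′ + (e + d₀)       ≡⟨ solve (c ∷ q′ ∷ e ∷ d₀ ∷ []) ⟩
  (c + e) + (q′ + d₀)     ≡⟨ cong₂ _+_ eq (sym eq′) ⟩
  (q + d₀) + (c′ + e)     ≡⟨ solve (q ∷ d₀ ∷ c′ ∷ e ∷ []) ⟩
  c′ + q + (e + d₀)       ∎))
  where open ≡-Reasoning
near-right {c = c} {c′} {e} e<t (exactˡ d₀ refl refl) = exactʳ (e + d₀) (ℕₚ.+-assoc c e d₀) (ℕₚ.+-assoc c′ e d₀)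
near-right {t} {e = e} e<t (farʳ far far′) = farˡ (shrink far) (shrink far′)
  where
  shrink : ∀ {a b} → a + (t + t) ≤ℕ b + e → a + t ≤ℕ b
  shrink {a} {b} far = ℕₚ.+-cancelʳ-≤ t (a + t) b
    (ℕₚ.≤-trans (ℕₚ.≤-reflexive (ℕₚ.+-assoc a t t)) (ℕₚ.≤-trans far (ℕₚ.+-monoʳ-≤ b (ℕₚ.<⇒≤ e<t))))
near-right {t} {e = e} e<t (farˡ far far′) = farʳ (shrink far) (shrink far′)
  where
  shrink : ∀ {a b} → a + e + (t + t) ≤ℕ b → a + t ≤ℕ b
  shrink {a} far = ℕₚ.≤-trans (ℕₚ.+-mono-≤ (ℕₚ.m≤m+n a e) (ℕₚ.m≤m+n t t)) far

far-between : ∀ {t q q′ l l′ r r′ c} → 1 ≤ℕ t → l + t ≤ℕ c → c + t ≤ℕ r →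
  (q ≤ℕ c → q ≤ℕ l) → (c ≤ℕ q → r ≤ℕ q) →
  SameGap (t + t) q l q′ l′ → SameGap (t + t) r q r′ q′ → SameGap (t + t) l r l′ r′ →
  SameGap t c q (l′ + t) q′
far-between {t} {q} {l = l} {l′} {r} {r′} {c} 1≤t l+t≤c c+t≤r q≤c⇒q≤l c≤q⇒r≤q ql rq lr with q ℕₚ.≤? c
... | yes q≤c = let q≤l = q≤c⇒q≤l q≤c in
  farˡ (ℕₚ.≤-trans (ℕₚ.+-monoˡ-≤ t q≤l) l+t≤c) (ℕₚ.+-monoˡ-≤ t (SameGap-≤ (1≤t+t 1≤t) ql q≤l))
... | no q≰c = let r≤q = c≤q⇒r≤q (ℕₚ.<⇒≤ (ℕₚ.≰⇒> q≰c)) in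
  farʳ (ℕₚ.≤-trans c+t≤r r≤q)
       (ℕₚ.≤-trans (subst (_≤ℕ r′) (sym (ℕₚ.+-assoc l′ t t)) l′+2t≤r′) (SameGap-≤ (1≤t+t 1≤t) rq r≤q))
  where
  l+2t≤r : l + (t + t) ≤ℕ r
  l+2t≤r = subst (_≤ℕ r) (ℕₚ.+-assoc l t t) (ℕₚ.≤-trans (ℕₚ.+-monoˡ-≤ t l+t≤c) c+t≤r)
  l′+2t≤r′ : l′ + (t + t) ≤ℕ r′
  l′+2t≤r′ = SameGap-+≤ (1≤t+t 1≤t) ℕₚ.≤-refl lr l+2t≤r

module _ {I : Set} (p p′ : I → ℕ) {t} (1≤t : 1 ≤ℕ t)
         (gaps : ∀ i j → SameGap (t + t) (p i) (p j) (p′ i) (p′ j)) where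

  -- c is matched at its offset from its left neighbour l or right neighbour r when that offset is
  -- below t, and t to the right of l′ when both gaps are wide.
  extend-gaps : ∀ c {l r} → p l ≤ℕ c → (∀ i → p i ≤ℕ c → p i ≤ℕ p l) →
    c ≤ℕ p r → (∀ i → c ≤ℕ p i → p r ≤ℕ p i) → Σ ℕ λ c′ → ∀ i → SameGap t c (p i) c′ (p′ i)
  extend-gaps c {l} {r} l≤c l-max c≤r r-min with c ℕₚ.<? p l + t
  ... | yes c<l+t = p′ l + d , λ i →
      subst (λ c → SameGap t c (p i) (p′ l + d) (p′ i)) (ℕₚ.m+[n∸m]≡n l≤c) (near-left d<t (gaps i l))
    where
    d = c ∸ p l
    d<t : d <ℕ t
    d<t = ℕₚ.+-cancelˡ-< (p l) d t (subst (_<ℕ p l + t) (sym (ℕₚ.m+[n∸m]≡n l≤c)) c<l+t)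
  ... | no c≮l+t with p r ℕₚ.<? c + t
  ...   | yes r<c+t = p′ r ∸ e , λ i →
      near-right e<t (subst₂ (λ r r′ → SameGap (t + t) (p i) r (p′ i) r′) r≡c+e r′≡c′+e (gaps i r))
    where
    e = p r ∸ c
    r≡c+e : p r ≡ c + e
    r≡c+e = sym (ℕₚ.m+[n∸m]≡n c≤r)
    e<t : e <ℕ t
    e<t = ℕₚ.+-cancelˡ-< c e t (subst (_<ℕ c + t) r≡c+e r<c+t)
    l′+t≤r′ : p′ l + t ≤ℕ p′ r
    l′+t≤r′ = SameGap-+≤ (1≤t+t 1≤t) (ℕₚ.m≤m+n t t) (gaps l r) (ℕₚ.≤-trans (ℕₚ.≮⇒≥ c≮l+t) c≤r)
    r′≡c′+e : p′ r ≡ p′ r ∸ e + e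
    r′≡c′+e = sym (ℕₚ.m∸n+n≡m (ℕₚ.≤-trans (ℕₚ.<⇒≤ e<t) (ℕₚ.m+n≤o⇒n≤o (p′ l) l′+t≤r′)))
  ...   | no r≮c+t = p′ l + t , λ i →
      far-between 1≤t (ℕₚ.≮⇒≥ c≮l+t) (ℕₚ.≮⇒≥ r≮c+t) (l-max i) (r-min i) (gaps i l) (gaps r i) (gaps l r)

module _ {_≼_ : ℕ → ℕ → Set} (≼-total : ∀ a b → a ≼ b ⊎ b ≼ a)
         (≼-trans : ∀ {a b c} → a ≼ b → b ≼ c → a ≼ c) where

  Best : ∀ {I : Set} → (I → Set) → (I → ℕ) → Set
  Best {I} Q p = (Σ I λ l → Q l × (∀ i → Q i → p i ≼ p l)) ⊎ (∀ i → ¬ Q i)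

  ≼-refl : ∀ a → a ≼ a
  ≼-refl a with ≼-total a a
  ... | inj₁ a≼a = a≼a
  ... | inj₂ a≼a = a≼a

  best-Fin : ∀ {w} {Q : Fin w → Set} → Decidable Q → (p : Fin w → ℕ) → Best Q p
  best-Fin {zero}  Q? p = inj₂ λ ()
  best-Fin {suc w} Q? p with best-Fin (Q? ∘ fs) (p ∘ fs) | Q? fz
  ... | inj₂ none       | no ¬q = inj₂ λ { fz q → ¬q q ; (fs i) q → none i q }
  ... | inj₂ none       | yes q = inj₁ (fz , q , λ { fz _ → ≼-refl (p fz) ; (fs i) qi → ⊥-elim (none i qi) })
  ... | inj₁ (l , ql , l-best) | no ¬q = inj₁ (fs l , ql , λ { fz q → ⊥-elim (¬q q) ; (fs i) qi → l-best i qi })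
  ... | inj₁ (l , ql , l-best) | yes q with ≼-total (p fz) (p (fs l))
  ...   | inj₁ fz≼l = inj₁ (fs l , ql , λ { fz _ → fz≼l ; (fs i) qi → l-best i qi })
  ...   | inj₂ l≼fz = inj₁ (fz , q , λ { fz _ → ≼-refl (p fz) ; (fs i) qi → ≼-trans (l-best i qi) l≼fz })

  best-⊎ : ∀ {A B : Set} {Q : A ⊎ B → Set} {p : A ⊎ B → ℕ} →
    Best (Q ∘ inj₁) (p ∘ inj₁) → Best (Q ∘ inj₂) (p ∘ inj₂) → Best Q p
  best-⊎ (inj₂ none₁) (inj₂ none₂) = inj₂ λ { (inj₁ a) → none₁ a ; (inj₂ b) → none₂ b }
  best-⊎ (inj₁ (l , ql , l-best)) (inj₂ none₂) =
    inj₁ (inj₁ l , ql , λ { (inj₁ a) q → l-best a q ; (inj₂ b) q → ⊥-elim (none₂ b q) })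
  best-⊎ (inj₂ none₁) (inj₁ (l , ql , l-best)) =
    inj₁ (inj₂ l , ql , λ { (inj₁ a) q → ⊥-elim (none₁ a q) ; (inj₂ b) q → l-best b q })
  best-⊎ {p = p} (inj₁ (l₁ , q₁ , best₁)) (inj₁ (l₂ , q₂ , best₂)) with ≼-total (p (inj₁ l₁)) (p (inj₂ l₂))
  ... | inj₁ l₁≼l₂ = inj₁ (inj₂ l₂ , q₂ , λ { (inj₁ a) q → ≼-trans (best₁ a q) l₁≼l₂ ; (inj₂ b) q → best₂ b q })
  ... | inj₂ l₂≼l₁ = inj₁ (inj₁ l₁ , q₁ , λ { (inj₁ a) q → best₁ a q ; (inj₂ b) q → ≼-trans (best₂ b q) l₂≼l₁ })

  best-Fin⊎Fin : ∀ {v c} {Q : Fin v ⊎ Fin c → Set} → Decidable Q → (p : Fin v ⊎ Fin c → ℕ) → Best Q p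
  best-Fin⊎Fin Q? p = best-⊎ (best-Fin (Q? ∘ inj₁) (p ∘ inj₁)) (best-Fin (Q? ∘ inj₂) (p ∘ inj₂))

-- Ehrenfeucht–Fraïssé argument

threshold : ∀ {v} → Formula v → ℕ
threshold (_ ≐ _)  = 1
threshold (_ <P _) = 1
threshold (_ <V _) = 1
threshold ⊤′       = 1
threshold ⊥′       = 1
threshold (¬′ φ)   = threshold φ
threshold (φ ∧′ ψ) = threshold φ ⊔ threshold ψ
threshold (φ ∨′ ψ) = threshold φ ⊔ threshold ψ
threshold (φ ⇒′ ψ) = threshold φ ⊔ threshold ψ
threshold (∃′ φ)   = threshold φ + threshold φ
threshold (∀′ φ)   = threshold φ + threshold φ

threshold-positive : ∀ {v} (φ : Formula v) → 1 ≤ℕ threshold φ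
threshold-positive (_ ≐ _)  = s≤s z≤n
threshold-positive (_ <P _) = s≤s z≤n
threshold-positive (_ <V _) = s≤s z≤n
threshold-positive ⊤′       = s≤s z≤n
threshold-positive ⊥′       = s≤s z≤n
threshold-positive (¬′ φ)   = threshold-positive φ
threshold-positive (φ ∧′ ψ) = ℕₚ.≤-trans (threshold-positive φ) (ℕₚ.m≤m⊔n _ _)
threshold-positive (φ ∨′ ψ) = ℕₚ.≤-trans (threshold-positive φ) (ℕₚ.m≤m⊔n _ _)
threshold-positive (φ ⇒′ ψ) = ℕₚ.≤-trans (threshold-positive φ) (ℕₚ.m≤m⊔n _ _)
threshold-positive (∃′ φ)   = ℕₚ.≤-trans (threshold-positive φ) (ℕₚ.m≤m+n _ _)
threshold-positive (∀′ φ)   = ℕₚ.≤-trans (threshold-positive φ) (ℕₚ.m≤m+n _ _)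

DefinesTranspositions : PermClass → Formula 2 → Set
DefinesTranspositions C φ =
  ∀ N (σ : Perm N) → C N σ → (a b : Fin N) → Sat σ (pair a b) φ ⇔ IsTransposition σ a b

-- Positions are shifted by one, so that the cut points 0 and N + 1 enclose all elements.
module GapGame {N} (σ : Perm N) {m} (cut : Fin m → ℕ) {lo hi : Fin m}
               (cut-lo : cut lo ≡ 0) (cut-hi : cut hi ≡ suc N) where

  location : ∀ {v} → (Fin v → Fin N) → Fin v ⊎ Fin m → ℕ
  location ρ (inj₁ x) = suc (toℕ (ρ x))
  location ρ (inj₂ j) = cut j

  Alike : ∀ {v} → ℕ → (Fin v → Fin N) → (Fin v → Fin N) → Set
  Alike t ρ ρ′ = ∀ i j → SameGap t (location ρ i) (location ρ j) (location ρ′ i) (location ρ′ j)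

  Alike-extend-by : ∀ {v t} {ρ ρ′ : Fin v → Fin N} {a a′} → Alike t ρ ρ′ →
    (∀ i → SameGap t (suc (toℕ a)) (location ρ i) (suc (toℕ a′)) (location ρ′ i)) →
    Alike t (extend ρ a) (extend ρ′ a′)
  Alike-extend-by alike new (inj₁ fz)     (inj₁ fz)     = SameGap-refl
  Alike-extend-by alike new (inj₁ fz)     (inj₁ (fs y)) = new (inj₁ y)
  Alike-extend-by alike new (inj₁ fz)     (inj₂ j)      = new (inj₂ j)
  Alike-extend-by alike new (inj₁ (fs x)) (inj₁ fz)     = SameGap-swap (new (inj₁ x))
  Alike-extend-by alike new (inj₂ i)      (inj₁ fz)     = SameGap-swap (new (inj₂ i))
  Alike-extend-by alike new (inj₁ (fs x)) (inj₁ (fs y)) = alike (inj₁ x) (inj₁ y)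
  Alike-extend-by alike new (inj₁ (fs x)) (inj₂ j)      = alike (inj₁ x) (inj₂ j)
  Alike-extend-by alike new (inj₂ i)      (inj₁ (fs y)) = alike (inj₂ i) (inj₁ y)
  Alike-extend-by alike new (inj₂ i)      (inj₂ j)      = alike (inj₂ i) (inj₂ j)

  location⁻¹ : ∀ {c} → 0 <ℕ c → c <ℕ suc N → Σ (Fin N) λ a → suc (toℕ a) ≡ c
  location⁻¹ {suc c} _ (s≤s c<N) = fromℕ< c<N , cong suc (Finₚ.toℕ-fromℕ< c<N)

  nearest-below : ∀ {v} (ρ : Fin v → Fin N) (a : Fin N) → Σ (Fin v ⊎ Fin m) λ l →
    location ρ l ≤ℕ suc (toℕ a) × (∀ i → location ρ i ≤ℕ suc (toℕ a) → location ρ i ≤ℕ location ρ l)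
  nearest-below ρ a with best-Fin⊎Fin ℕₚ.≤-total ℕₚ.≤-trans (λ i → location ρ i ℕₚ.≤? suc (toℕ a)) (location ρ)
  ... | inj₁ nearest = nearest
  ... | inj₂ none    = ⊥-elim (none (inj₂ lo) (subst (_≤ℕ suc (toℕ a)) (sym cut-lo) z≤n))

  nearest-above : ∀ {v} (ρ : Fin v → Fin N) (a : Fin N) → Σ (Fin v ⊎ Fin m) λ r →
    suc (toℕ a) ≤ℕ location ρ r × (∀ i → suc (toℕ a) ≤ℕ location ρ i → location ρ r ≤ℕ location ρ i)
  nearest-above ρ a with best-Fin⊎Fin (λ a b → ℕₚ.≤-total b a) (λ a≥b b≥c → ℕₚ.≤-trans b≥c a≥b)
                           (λ i → suc (toℕ a) ℕₚ.≤? location ρ i) (location ρ)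
  ... | inj₁ nearest = nearest
  ... | inj₂ none    = ⊥-elim (none (inj₂ hi) (subst (suc (toℕ a) ≤ℕ_) (sym cut-hi) (s≤s (ℕₚ.<⇒≤ (Finₚ.toℕ<n a)))))

  Alike-extend : ∀ {v u} {ρ ρ′ : Fin v → Fin N} → 1 ≤ℕ u → Alike (u + u) ρ ρ′ → (a : Fin N) →
    Σ (Fin N) λ a′ → Alike u (extend ρ a) (extend ρ′ a′)
  Alike-extend {v} {u} {ρ} {ρ′} 1≤u alike a =
    let (l , l≤c , l-max) = nearest-below ρ a
        (r , c≤r , r-min) = nearest-above ρ a
        (c′ , gaps) = extend-gaps (location ρ) (location ρ′) 1≤u alike c {l} {r} l≤c l-max c≤r r-min
        0<c′ = subst₂ _<ℕ_ cut-lo refl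
                 (SameGap-< 1≤u (SameGap-swap (gaps (inj₂ lo))) (subst (_<ℕ c) (sym cut-lo) (s≤s z≤n)))
        c′<1+N = subst (c′ <ℕ_) cut-hi
                   (SameGap-< 1≤u (gaps (inj₂ hi)) (subst (c <ℕ_) (sym cut-hi) (s≤s (Finₚ.toℕ<n a))))
        (a′ , a′↦c′) = location⁻¹ 0<c′ c′<1+N
    in a′ , Alike-extend-by (λ i j → SameGap-mono (ℕₚ.m≤m+n u u) (alike i j))
              (λ i → subst (λ c′ → SameGap u c (location ρ i) c′ (location ρ′ i)) (sym a′↦c′) (gaps i))
    where c = suc (toℕ a)

  Alike-sym : ∀ {v t} {ρ ρ′ : Fin v → Fin N} → Alike t ρ ρ′ → Alike t ρ′ ρ
  Alike-sym alike i j = SameGap-sym (alike i j)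

  Alike-mono : ∀ {v t u} {ρ ρ′ : Fin v → Fin N} → u ≤ℕ t → Alike t ρ ρ′ → Alike u ρ ρ′
  Alike-mono u≤t alike i j = SameGap-mono u≤t (alike i j)

  Alike-≡ : ∀ {v t} {ρ ρ′ : Fin v → Fin N} → 1 ≤ℕ t → Alike t ρ ρ′ → ∀ x y → ρ x ≡ ρ y → ρ′ x ≡ ρ′ y
  Alike-≡ 1≤t alike x y ρx≡ρy =
    Finₚ.toℕ-injective (ℕₚ.suc-injective (SameGap-≡ 1≤t (alike (inj₁ x) (inj₁ y)) (cong (suc ∘ toℕ) ρx≡ρy)))

  Alike-< : ∀ {v t} {ρ ρ′ : Fin v → Fin N} → 1 ≤ℕ t → Alike t ρ ρ′ → ∀ x y → ρ x < ρ y → ρ′ x < ρ′ y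
  Alike-< 1≤t alike x y ρx<ρy = ℕ.s≤s⁻¹ (SameGap-< 1≤t (alike (inj₁ x) (inj₁ y)) (s≤s ρx<ρy))

  ValuesDeterminedByGaps : Set
  ValuesDeterminedByGaps = ∀ {v} {ρ ρ′ : Fin v → Fin N} → Alike 1 ρ ρ′ → ∀ x y →
    proj₁ σ (ρ x) < proj₁ σ (ρ y) → proj₁ σ (ρ′ x) < proj₁ σ (ρ′ y)

  Alike-Sat : ValuesDeterminedByGaps → ∀ {v t} (φ : Formula v) → threshold φ ≤ℕ t →
    {ρ ρ′ : Fin v → Fin N} → Alike t ρ ρ′ → Sat σ ρ φ ⇔ Sat σ ρ′ φ
  Alike-Sat values (x ≐ y) 1≤t alike = mk⇔ (Alike-≡ 1≤t alike x y) (Alike-≡ 1≤t (Alike-sym alike) x y)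
  Alike-Sat values (x <P y) 1≤t alike = mk⇔ (Alike-< 1≤t alike x y) (Alike-< 1≤t (Alike-sym alike) x y)
  Alike-Sat values (x <V y) 1≤t alike =
    mk⇔ (values (Alike-mono 1≤t alike) x y) (values (Alike-mono 1≤t (Alike-sym alike)) x y)
  Alike-Sat values ⊤′ _ _ = ⇔-id _
  Alike-Sat values ⊥′ _ _ = ⇔-id _
  Alike-Sat values (¬′ φ) ≤t alike = ¬-cong-⇔ (Alike-Sat values φ ≤t alike)
  Alike-Sat values (φ ∧′ ψ) ≤t alike =
    Alike-Sat values φ (ℕₚ.m⊔n≤o⇒m≤o _ _ ≤t) alike ×-⇔ Alike-Sat values ψ (ℕₚ.m⊔n≤o⇒n≤o _ _ ≤t) alike
  Alike-Sat values (φ ∨′ ψ) ≤t alike =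
    Alike-Sat values φ (ℕₚ.m⊔n≤o⇒m≤o _ _ ≤t) alike ⊎-⇔ Alike-Sat values ψ (ℕₚ.m⊔n≤o⇒n≤o _ _ ≤t) alike
  Alike-Sat values (φ ⇒′ ψ) ≤t alike =
    →-cong-⇔ (Alike-Sat values φ (ℕₚ.m⊔n≤o⇒m≤o _ _ ≤t) alike) (Alike-Sat values ψ (ℕₚ.m⊔n≤o⇒n≤o _ _ ≤t) alike)
  Alike-Sat values (∃′ φ) ≤t alike = mk⇔
    (λ (a , sat) → let (a′ , alike′) = Alike-extend (threshold-positive φ) (Alike-mono ≤t alike) a in
      a′ , to (Alike-Sat values φ ℕₚ.≤-refl alike′) sat)
    (λ (a′ , sat) → let (a , alike′) = Alike-extend (threshold-positive φ) (Alike-mono ≤t (Alike-sym alike)) a′ in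
      a , from (Alike-Sat values φ ℕₚ.≤-refl (Alike-sym alike′)) sat)
  Alike-Sat values (∀′ φ) ≤t alike = mk⇔
    (λ sat a′ → let (a , alike′) = Alike-extend (threshold-positive φ) (Alike-mono ≤t (Alike-sym alike)) a′ in
      to (Alike-Sat values φ ℕₚ.≤-refl (Alike-sym alike′)) (sat a))
    (λ sat a → let (a′ , alike′) = Alike-extend (threshold-positive φ) (Alike-mono ≤t alike) a in
      from (Alike-Sat values φ ℕₚ.≤-refl alike′) (sat a′))

  Alike-pair : ∀ {t} {x y y′ : Fin N} →
    SameGap t (suc (toℕ y)) (suc (toℕ x)) (suc (toℕ y′)) (suc (toℕ x)) →
    (∀ j → SameGap t (suc (toℕ y)) (cut j) (suc (toℕ y′)) (cut j)) →
    Alike t (pair x y) (pair x y′)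
  Alike-pair yx ycut (inj₁ fz)      (inj₁ fz)      = SameGap-refl
  Alike-pair yx ycut (inj₁ fz)      (inj₁ (fs fz)) = SameGap-swap yx
  Alike-pair yx ycut (inj₁ (fs fz)) (inj₁ fz)      = yx
  Alike-pair yx ycut (inj₁ (fs fz)) (inj₁ (fs fz)) = SameGap-refl
  Alike-pair yx ycut (inj₁ (fs fz)) (inj₂ j)       = ycut j
  Alike-pair yx ycut (inj₂ i)       (inj₁ (fs fz)) = SameGap-swap (ycut i)
  Alike-pair yx ycut (inj₁ fz)      (inj₂ j)       = SameGap-same _ _
  Alike-pair yx ycut (inj₂ i)       (inj₁ fz)      = SameGap-same _ _
  Alike-pair yx ycut (inj₂ i)       (inj₂ j)       = SameGap-same _ _

  Alike-IsTransposition : ∀ {C φ} → DefinesTranspositions C φ → C N σ → ValuesDeterminedByGaps →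
    ∀ {x y y′} → Alike (threshold φ) (pair x y) (pair x y′) → IsTransposition σ x y → IsTransposition σ x y′
  Alike-IsTransposition {φ = φ} defines σ∈C values {x} {y} {y′} alike =
    to (defines N σ σ∈C x y′) ∘ to (Alike-Sat values φ ℕₚ.≤-refl alike) ∘ from (defines N σ σ∈C x y)

decreasing-antitone : ∀ {k} {σ : Perm k} → IsDecreasing k σ → ∀ {i j} → i < j → proj₁ σ j < proj₁ σ i
decreasing-antitone {suc k} decreasing {i} {j} i<j rewrite decreasing i | decreasing j =
  ℕₚ.∸-monoʳ-< i<j (ℕ.s≤s⁻¹ (Finₚ.toℕ<n j))

-- In δ_K with K = 3t + 2, the transposition (t, 2t + 1) looks like the pair (t, 2t) at scale t.
module _ {C : PermClass} {φ : Formula 2} (defines : DefinesTranspositions C φ) where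

  private
    t = threshold φ
    K = suc (suc (t + t + t))

  definable⇒δ∉C : ¬ K ∈δ C
  definable⇒δ∉C (σ , decreasing , σ∈C) =
    σx≢y′ (proj₁ (proj₂ (Alike-IsTransposition defines σ∈C values alike (x≢y , σx≡y , σy≡x))))
    where
    x<K : t <ℕ K
    x<K = s≤s (ℕₚ.≤-trans (ℕₚ.m≤n+m t (t + t)) (ℕₚ.n≤1+n _))
    y<K : suc (t + t) <ℕ K
    y<K = s≤s (s≤s (ℕₚ.m≤m+n (t + t) t))
    y′<K : t + t <ℕ K
    y′<K = s≤s (ℕₚ.≤-trans (ℕₚ.m≤m+n (t + t) t) (ℕₚ.n≤1+n _))
    x y y′ : Fin K
    x  = fromℕ< x<K
    y  = fromℕ< y<K
    y′ = fromℕ< y′<K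
    cut : Fin 2 → ℕ
    cut fz      = 0
    cut (fs fz) = suc K
    open GapGame σ cut {fz} {fs fz} refl refl
    values : ValuesDeterminedByGaps
    values alike a b =
      from (<-⇔-decreasing antitone _ _) ∘ Alike-< ℕₚ.≤-refl alike b a ∘ to (<-⇔-decreasing antitone _ _)
      where antitone = decreasing-antitone {σ = σ} decreasing
    tx : toℕ x ≡ t
    tx = Finₚ.toℕ-fromℕ< x<K
    ty : toℕ y ≡ suc (t + t)
    ty = Finₚ.toℕ-fromℕ< y<K
    ty′ : toℕ y′ ≡ t + t
    ty′ = Finₚ.toℕ-fromℕ< y′<K
    yx : SameGap t (suc (toℕ y)) (suc (toℕ x)) (suc (toℕ y′)) (suc (toℕ x))
    yx rewrite tx | ty | ty′ = farˡ (ℕₚ.n≤1+n _) ℕₚ.≤-refl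
    ycut : ∀ j → SameGap t (suc (toℕ y)) (cut j) (suc (toℕ y′)) (cut j)
    ycut fz      rewrite ty | ty′ = farˡ (ℕₚ.m≤n⇒m≤1+n (ℕₚ.m≤n⇒m≤1+n (ℕₚ.m≤m+n t t))) (ℕₚ.m≤n⇒m≤1+n (ℕₚ.m≤m+n t t))
    ycut (fs fz) rewrite ty | ty′ = farʳ (ℕₚ.n≤1+n _) (ℕₚ.m≤n⇒m≤1+n (ℕₚ.n≤1+n _))
    alike : Alike t (pair x y) (pair x y′)
    alike = Alike-pair yx ycut
    x≢y : x ≢ y
    x≢y x≡y = ℕₚ.<-irrefl (trans (sym tx) (trans (cong toℕ x≡y) ty)) (s≤s (ℕₚ.m≤m+n t t))
    σx≡y : proj₁ σ x ≡ y
    σx≡y = Finₚ.toℕ-injective (begin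
      toℕ (proj₁ σ x)         ≡⟨ decreasing x ⟩
      suc (t + t + t) ∸ toℕ x ≡⟨ cong (suc (t + t + t) ∸_) tx ⟩
      suc (t + t) + t ∸ t     ≡⟨ ℕₚ.m+n∸n≡m (suc (t + t)) t ⟩
      suc (t + t)             ≡⟨ ty ⟨
      toℕ y                   ∎)
      where open ≡-Reasoning
    σy≡x : proj₁ σ y ≡ x
    σy≡x = Finₚ.toℕ-injective (begin
      toℕ (proj₁ σ y)           ≡⟨ decreasing y ⟩
      suc (t + t + t) ∸ toℕ y   ≡⟨ cong (suc (t + t + t) ∸_) ty ⟩
      suc (t + t) + t ∸ suc (t + t) ≡⟨ ℕₚ.m+n∸m≡n (suc (t + t)) t ⟩
      t                         ≡⟨ tx ⟨
      toℕ x                     ∎)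
      where open ≡-Reasoning
    σx≢y′ : proj₁ σ x ≢ y′
    σx≢y′ σx≡y′ = ℕₚ.<-irrefl (trans (sym ty′) (trans (cong toℕ (trans (sym σx≡y′) σx≡y)) ty)) (ℕₚ.n<1+n (t + t))

module IotaMinusIota {m n} {σ : Perm (m + n)} (isι⊖ι : IsIotaMinusIota m n σ) where

  private
    s = proj₁ σ

  InFirstBlock : Fin (m + n) → Set
  InFirstBlock a = toℕ a <ℕ m

  ValueBefore : Fin (m + n) → Fin (m + n) → Set
  ValueBefore a b = (InFirstBlock a × InFirstBlock b × a < b)
                  ⊎ (¬ InFirstBlock a × InFirstBlock b)
                  ⊎ (¬ InFirstBlock a × ¬ InFirstBlock b × a < b)

  value-first : ∀ a → InFirstBlock a → toℕ (s a) ≡ n + toℕ a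
  value-first a a<m with toℕ a <ᵇ m | ℕₚ.<ᵇ-reflects-< (toℕ a) m | isι⊖ι a
  ... | true  | _       | eq = eq
  ... | false | ofⁿ a≮m | _  = ⊥-elim (a≮m a<m)

  value-second : ∀ a → ¬ InFirstBlock a → toℕ (s a) ≡ toℕ a ∸ m
  value-second a a≮m with toℕ a <ᵇ m | ℕₚ.<ᵇ-reflects-< (toℕ a) m | isι⊖ι a
  ... | false | _       | eq = eq
  ... | true  | ofʸ a<m | _  = ⊥-elim (a≮m a<m)

  private
    second<first : ∀ {a b} → ¬ InFirstBlock a → InFirstBlock b → toℕ a ∸ m <ℕ n + toℕ b
    second<first {a} {b} a≮m _ = ℕₚ.<-≤-trans
      (subst (toℕ a ∸ m <ℕ_) (ℕₚ.m+n∸m≡n m n) (ℕₚ.∸-monoˡ-< (Finₚ.toℕ<n a) (ℕₚ.≮⇒≥ a≮m)))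
      (ℕₚ.m≤m+n n (toℕ b))

  ι⊖ι-< : ∀ a b → s a < s b ⇔ ValueBefore a b
  ι⊖ι-< a b = mk⇔ (⇒ (toℕ a ℕₚ.<? m) (toℕ b ℕₚ.<? m)) ⇐
    where
    ⇒ : Dec (InFirstBlock a) → Dec (InFirstBlock b) → s a < s b → ValueBefore a b
    ⇒ (yes a<m) (yes b<m) sa<sb = inj₁ (a<m , b<m ,
      ℕₚ.+-cancelˡ-< n (toℕ a) (toℕ b) (subst₂ _<ℕ_ (value-first a a<m) (value-first b b<m) sa<sb))
    ⇒ (yes a<m) (no b≮m) sa<sb = ⊥-elim (ℕₚ.<-asym
      (subst₂ _<ℕ_ (value-first a a<m) (value-second b b≮m) sa<sb) (second<first b≮m a<m))
    ⇒ (no a≮m) (yes b<m) _ = inj₂ (inj₁ (a≮m , b<m))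
    ⇒ (no a≮m) (no b≮m) sa<sb = inj₂ (inj₂ (a≮m , b≮m ,
      subst₂ _<ℕ_ (ℕₚ.m+[n∸m]≡n (ℕₚ.≮⇒≥ a≮m)) (ℕₚ.m+[n∸m]≡n (ℕₚ.≮⇒≥ b≮m))
        (ℕₚ.+-monoʳ-< m (subst₂ _<ℕ_ (value-second a a≮m) (value-second b b≮m) sa<sb))))
    ⇐ : ValueBefore a b → s a < s b
    ⇐ (inj₁ (a<m , b<m , a<b)) =
      subst₂ _<ℕ_ (sym (value-first a a<m)) (sym (value-first b b<m)) (ℕₚ.+-monoʳ-< n a<b)
    ⇐ (inj₂ (inj₁ (a≮m , b<m))) =
      subst₂ _<ℕ_ (sym (value-second a a≮m)) (sym (value-first b b<m)) (second<first a≮m b<m)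
    ⇐ (inj₂ (inj₂ (a≮m , b≮m , a<b))) =
      subst₂ _<ℕ_ (sym (value-second a a≮m)) (sym (value-second b b≮m)) (ℕₚ.∸-monoˡ-< a<b (ℕₚ.≮⇒≥ a≮m))

-- In ι_M ⊖ ι_M with M = 2t + 1 and a cut at M, the transposition (t, M + t) looks like the pair
-- (t, M + t + 1) at scale t.
module _ {C : PermClass} {φ : Formula 2} (defines : DefinesTranspositions C φ) where

  private
    t = threshold φ
    1≤t = threshold-positive φ
    M = suc (t + t)

  definable⇒ι⊖ι∉C : ¬ M , M ∈⊖ C
  definable⇒ι⊖ι∉C (σ , isι⊖ι , σ∈C) =
    σx≢y′ (proj₁ (proj₂ (Alike-IsTransposition defines σ∈C values alike (x≢y , σx≡y , σy≡x))))
    where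
    x<2M : t <ℕ M + M
    x<2M = s≤s (ℕₚ.≤-trans (ℕₚ.m≤m+n t t) (ℕₚ.m≤m+n (t + t) M))
    y<2M : M + t <ℕ M + M
    y<2M = subst (M + t <ℕ_) (sym (ℕₚ.+-suc M (t + t))) (s≤s (ℕₚ.+-monoʳ-≤ M (ℕₚ.m≤m+n t t)))
    y′<2M : M + suc t <ℕ M + M
    y′<2M = subst (M + suc t <ℕ_) (sym (ℕₚ.+-suc M (t + t))) (s≤s (ℕₚ.+-monoʳ-≤ M (ℕₚ.+-monoˡ-≤ t 1≤t)))
    x y y′ : Fin (M + M)
    x  = fromℕ< x<2M
    y  = fromℕ< y<2M
    y′ = fromℕ< y′<2M
    tx : toℕ x ≡ t
    tx = Finₚ.toℕ-fromℕ< x<2M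
    ty : toℕ y ≡ M + t
    ty = Finₚ.toℕ-fromℕ< y<2M
    ty′ : toℕ y′ ≡ M + suc t
    ty′ = Finₚ.toℕ-fromℕ< y′<2M
    cut : Fin 3 → ℕ
    cut fz           = 0
    cut (fs fz)      = suc (M + M)
    cut (fs (fs fz)) = M
    open GapGame σ cut {fz} {fs fz} refl refl
    open IotaMinusIota {M} {M} {σ} isι⊖ι
    values : ValuesDeterminedByGaps
    values {ρ = ρ} {ρ′} alike a b = from (ι⊖ι-< (ρ′ a) (ρ′ b)) ∘ transfer ∘ to (ι⊖ι-< (ρ a) (ρ b))
      where
      stays-first : ∀ z → InFirstBlock (ρ z) → InFirstBlock (ρ′ z)
      stays-first z = SameGap-≤ ℕₚ.≤-refl (alike (inj₁ z) (inj₂ (fs (fs fz))))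
      stays-second : ∀ z → ¬ InFirstBlock (ρ z) → ¬ InFirstBlock (ρ′ z)
      stays-second z ¬first = ¬first ∘ SameGap-≤ ℕₚ.≤-refl (SameGap-sym (alike (inj₁ z) (inj₂ (fs (fs fz)))))
      transfer : ValueBefore (ρ a) (ρ b) → ValueBefore (ρ′ a) (ρ′ b)
      transfer (inj₁ (fa , fb , a<b)) =
        inj₁ (stays-first a fa , stays-first b fb , Alike-< ℕₚ.≤-refl alike a b a<b)
      transfer (inj₂ (inj₁ (sa , fb))) =
        inj₂ (inj₁ (stays-second a sa , stays-first b fb))
      transfer (inj₂ (inj₂ (sa , sb , a<b))) =
        inj₂ (inj₂ (stays-second a sa , stays-second b sb , Alike-< ℕₚ.≤-refl alike a b a<b))
    t≤M : t ≤ℕ M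
    t≤M = ℕₚ.≤-trans (ℕₚ.m≤m+n t t) (ℕₚ.n≤1+n _)
    yx : SameGap t (suc (toℕ y)) (suc (toℕ x)) (suc (toℕ y′)) (suc (toℕ x))
    yx rewrite tx | ty | ty′ =
      farˡ (s≤s (ℕₚ.+-monoˡ-≤ t t≤M)) (s≤s (ℕₚ.≤-trans (ℕₚ.+-monoˡ-≤ t t≤M) (ℕₚ.+-monoʳ-≤ M (ℕₚ.n≤1+n t))))
    ycut : ∀ j → SameGap t (suc (toℕ y)) (cut j) (suc (toℕ y′)) (cut j)
    ycut fz rewrite ty | ty′ =
      farˡ (ℕₚ.m≤n⇒m≤1+n (ℕₚ.m≤n+m t M)) (ℕₚ.m≤n⇒m≤1+n (ℕₚ.≤-trans (ℕₚ.n≤1+n t) (ℕₚ.m≤n+m (suc t) M)))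
    ycut (fs fz) rewrite ty | ty′ =
      farʳ (s≤s (subst (_≤ℕ M + M) (sym (ℕₚ.+-assoc M t t)) (ℕₚ.+-monoʳ-≤ M (ℕₚ.n≤1+n _))))
           (s≤s (ℕₚ.≤-reflexive (ℕₚ.+-assoc M (suc t) t)))
    ycut (fs (fs fz)) rewrite ty | ty′ =
      farˡ (ℕₚ.n≤1+n _) (ℕₚ.m≤n⇒m≤1+n (ℕₚ.+-monoʳ-≤ M (ℕₚ.n≤1+n t)))
    alike : Alike t (pair x y) (pair x y′)
    alike = Alike-pair yx ycut
    x≢y : x ≢ y
    x≢y x≡y = ℕₚ.<-irrefl (trans (sym tx) (trans (cong toℕ x≡y) ty)) (ℕₚ.m<n+m t (s≤s z≤n))
    x-first : InFirstBlock x
    x-first = subst (_<ℕ M) (sym tx) (s≤s (ℕₚ.m≤m+n t t))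
    σx≡y : proj₁ σ x ≡ y
    σx≡y = Finₚ.toℕ-injective (trans (value-first x x-first) (trans (cong (M +_) tx) (sym ty)))
    σy≡x : proj₁ σ y ≡ x
    σy≡x = Finₚ.toℕ-injective (begin
      toℕ (proj₁ σ y) ≡⟨ value-second y y-second ⟩
      toℕ y ∸ M       ≡⟨ cong (_∸ M) ty ⟩
      M + t ∸ M       ≡⟨ ℕₚ.m+n∸m≡n M t ⟩
      t               ≡⟨ tx ⟨
      toℕ x           ∎)
      where
      open ≡-Reasoning
      y-second : ¬ InFirstBlock y
      y-second y<M = ℕₚ.m+n≮m M t (subst (_<ℕ M) ty y<M)
    σx≢y′ : proj₁ σ x ≢ y′
    σx≢y′ σx≡y′ = ℕₚ.<-irrefl (trans (sym ty) (trans (cong toℕ (trans (sym σx≡y) σx≡y′)) ty′))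
                               (ℕₚ.+-monoʳ-< M (ℕₚ.n<1+n t))

theorem5p7 : (C : PermClass) → IsPermClass C →
    (Σ (Formula 2) λ φ → ∀ N (σ : Perm N) → C N σ → (a b : Fin N) →
        Sat σ (pair a b) φ ⇔ IsTransposition σ a b)
    ⇔
    (Σ ℕ λ k → Σ ℕ λ m → Σ ℕ λ n →
        2 ≤ℕ k × 1 ≤ℕ m × 1 ≤ℕ n × ¬ (k ∈δ C) × ¬ (m , n ∈⊖ C))
theorem5p7 C C-closed = mk⇔
  (λ (φ , defines) →
    _ , _ , _ , s≤s (s≤s z≤n) , s≤s z≤n , s≤s z≤n , definable⇒δ∉C defines , definable⇒ι⊖ι∉C defines)
  (λ (k , m , n , _ , _ , _ , δk∉C , ι⊖ι∉C) →
    transposition C C-closed {k} {m} {n} δk∉C ι⊖ι∉C , λ N σ σ∈C → Sat-transposition C C-closed δk∉C ι⊖ι∉C σ σ∈C)
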